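{- Let $k,\ell\geq 1$ be integers and let $G$ be a graph containing a bramble of order at least $k\ell$. Then $G$ contains $\ell$ pairwise vertex-disjoint paths $P_1,\dots,P_\ell$ such that for all distinct $i,j\in\{1,\dots,\ell\}$, $G$ contains $k$ pairwise vertex-disjoint paths between $P_i$ and $P_j$.
   Context: All graphs are finite, simple and undirected. Two subgraphs $X,Y$ of $G$ touch if they share a vertex or some edge of $G$ has one endpoint in $X$ and the other in $Y$. A bramble in $G$ is a set of pairwise touching connected subgraphs of $G$. A hitting set of a bramble $\mathcal{B}$ is a set of vertices meeting every element of $\mathcal{B}$; the order of $\mathcal{B}$ is the minimum size of a hitting set. -}

module Defs where

open import Level using (0ℓ)
open import Data.Nat using (ℕ; _≤_)
open import Data.Fin using (Fin)
open import Data.Fin.Subset using (Subset; _∈_; ∣_∣)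
open import Data.List using (List; []; _∷_; head; last)
open import Data.List.Membership.Propositional using () renaming (_∈_ to _∈ₗ_)
open import Data.List.Relation.Unary.Linked using (Linked)
open import Data.List.Relation.Unary.Unique.Propositional using (Unique)
open import Data.Maybe using (Maybe; just)
open import Data.Product using (Σ; ∃; ∃-syntax; _×_)
open import Data.Sum using (_⊎_)
open import Relation.Nullary using (¬_)
open import Relation.Binary.PropositionalEquality using (_≡_; _≢_)

record Graph (n : ℕ) : Set₁ where
  field
    _~_     : Fin n → Fin n → Set
    ~-sym   : ∀ {u v} → u ~ v → v ~ u
    ~-irrefl : ∀ {v} → ¬ (v ~ v)
open Graph public

module _ {n : ℕ} (G : Graph n) where

  record Subgraph : Set₁ where
    field
      V      : Subset n
      E      : Fin n → Fin n → Set
      E-sym  : ∀ {u v} → E u v → E v u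
      E-edge : ∀ {u v} → E u v → _~_ G u v
      E-ends : ∀ {u v} → E u v → u ∈ V × v ∈ V
  open Subgraph public

  Connected : Subgraph → Set
  Connected H =
    (∃[ v ] v ∈ V H) ×
    (∀ u v → u ∈ V H → v ∈ V H →
      ∃[ w ] (Linked (E H) w × head w ≡ just u × last w ≡ just v))

  Touch : Subgraph → Subgraph → Set
  Touch X Y = (∃[ v ] (v ∈ V X × v ∈ V Y))
            ⊎ (∃[ u ] ∃[ v ] (u ∈ V X × v ∈ V Y × _~_ G u v))

  record Bramble : Set₁ where
    field
      members   : List Subgraph
      connected : ∀ {X} → X ∈ₗ members → Connected X
      touching  : ∀ {X Y} → X ∈ₗ members → Y ∈ₗ members → Touch X Y
  open Bramble public

  HittingSet : Bramble → Subset n → Set₁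
  HittingSet B S = ∀ {X} → X ∈ₗ members B → ∃[ v ] (v ∈ S × v ∈ V X)

  OrderAtLeast : Bramble → ℕ → Set₁
  OrderAtLeast B m = ∀ (S : Subset n) → HittingSet B S → m ≤ ∣ S ∣

  record Path : Set where
    field
      verts    : List (Fin n)
      nonempty : verts ≢ []
      distinct : Unique verts
      adjacent : Linked (_~_ G) verts
  open Path public

  Disjoint : Path → Path → Set
  Disjoint P Q = ∀ v → v ∈ₗ verts P → v ∈ₗ verts Q → ⊥'
    where open import Data.Empty renaming (⊥ to ⊥')

  -- Q is a path between P and R (an V(P)–V(R) path in Diestel's sense):
  -- Q starts in V(P), ends in V(R), and meets V(P) only in its first vertex
  -- and V(R) only in its last vertex.
  PathBetween : Path → Path → Path → Set
  PathBetween P R Q =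
    (∃[ a ] (head (verts Q) ≡ just a × a ∈ₗ verts P)) ×
    (∃[ b ] (last (verts Q) ≡ just b × b ∈ₗ verts R)) ×
    (∀ v → v ∈ₗ verts Q → v ∈ₗ verts P → head (verts Q) ≡ just v) ×
    (∀ v → v ∈ₗ verts Q → v ∈ₗ verts R → last (verts Q) ≡ just v)

-- Adjacency in G need not be decidable, so all searches run in the graph spanned by
-- the finitely many edges of G used by the witnesses that the bramble members are
-- connected and touch (module Spanning).  The proof then has three steps.
--  1. Greedily grow a path meeting every member of the bramble (MeetingPath).
--  2. Cut it into ℓ disjoint segments such that every set of fewer than k vertices
--     misses some member meeting the segment: cut off the shortest prefix whose
--     members have order at least k; the members missing it still have order at
--     least k(ℓ-1) (Segments).
--  3. Two segments cannot be separated by fewer than k vertices, since such a set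
--     misses two members meeting them, and these touch.  Menger's theorem, proved
--     by induction on the number of edges (MengerStep), gives k disjoint walks
--     between them, which contain the required paths (abPath).
module Submission where

open import Defs
open import Level using (0ℓ)
open import Function using (id; _∘_)
open import Data.Nat using (ℕ; zero; suc; _≤_; _<_; _*_; _+_; z≤n; s≤s)
open import Data.Nat.Properties
  using (≤-refl; ≤-reflexive; ≤-trans; ≤-pred; <-irrefl; <⇒≤; n≤1+n; n<1+n; m≤n⇒m≤1+n; m≤m+n; m≤m*n;
         n≮0; n≮n; ≮⇒≥; _≤?_; +-comm; +-suc; +-mono-≤; +-monoʳ-≤; *-suc; *-identityʳ; module ≤-Reasoning)
open import Data.Fin using (Fin; zero; suc)
import Data.Fin.Base as F
open import Data.Fin.Properties using (any?) renaming (_≟_ to _≟F_; suc-injective to Fin-suc-injective)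
open import Data.Fin.Subset using (Subset; _∈_; _∉_; ∣_∣; _∪_; ⁅_⁆; _-_; inside; outside) renaming (⊤ to full; ⊥ to ∅)
open import Data.Fin.Subset.Properties
  using (anySubset?; p⊆q⇒∣p∣≤∣q∣; x∈p⇒∣p-x∣<∣p∣; x∈p∧x≢y⇒x∈p-y; x∈p∪q⁺; x∈p∪q⁻; x∈⁅x⁆; x∈⁅y⁆⇒x≡y;
         ∈⊤; ∣⁅x⁆∣≡1; ∣⊤∣≡n; ∣⊥∣≡0)
  renaming (_∈?_ to _∈S?_)
open import Data.Vec.Base using ([]; _∷_) renaming (here to ∈-head; there to ∈-tail)
open import Data.List using (List; []; _∷_; head; last; length; _++_; map; concat; concatMap; allFin; tabulate)
open import Data.List.Properties using (length-map; length-tabulate; ++-assoc; ++-identityʳ)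
open import Data.List.Membership.Propositional using (mapWith∈; lose; find) renaming (_∈_ to _∈ₗ_)
open import Data.List.Membership.Propositional.Properties
  using (∈-map⁺; ∈-map⁻; ∈-++⁺ˡ; ∈-++⁺ʳ; ∈-++⁻; ∈-concat⁺′; ∈-concatMap⁺; ∈-allFin)
import Data.List.Membership.DecPropositional as DecMem
import Data.List.Relation.Unary.Any as Any
open import Data.List.Relation.Unary.Any using (Any; here; there)
import Data.List.Relation.Unary.All as All
open import Data.List.Relation.Unary.All using (All; []; _∷_)
import Data.List.Relation.Unary.All.Properties as AllP
open import Data.List.Relation.Unary.AllPairs using ([]; _∷_)
open import Data.List.Relation.Unary.Unique.Propositional using (Unique)
import Data.List.Relation.Unary.Unique.Propositional.Properties as Unique
open import Data.List.Relation.Unary.Linked using (Linked; []; [-]; _∷_)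
import Data.List.Relation.Unary.Linked as L
open import Data.Maybe using (just)
import Data.Product
open import Data.Product using (Σ; ∃; _×_; _,_; proj₁; proj₂)
open import Data.Product.Properties using (≡-dec)
import Data.Sum as Sum
open import Data.Sum using (_⊎_; inj₁; inj₂)
open import Data.Empty using (⊥; ⊥-elim)
open import Data.Unit using (⊤; tt)
open import Relation.Nullary using (¬_; Dec; yes; no; does)
open import Relation.Nullary.Decidable using (_×-dec_; _⊎-dec_; _→-dec_; ¬?)
open import Relation.Unary using (Pred; Decidable)
open import Relation.Binary.PropositionalEquality using (_≡_; _≢_; refl; sym; trans; cong; subst)

-- Walks in the graph spanned by a finite list of edges.

Edge : ℕ → Set
Edge n = Fin n × Fin n

Adj : ∀ {n} → List (Edge n) → Fin n → Fin n → Set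
Adj Es u v = (u , v) ∈ₗ Es ⊎ (v , u) ∈ₗ Es

data Walk {n} (Es : List (Edge n)) : Fin n → Fin n → Set where
  [_]    : ∀ a → Walk Es a a
  _∷⟨_⟩_ : ∀ a {b c} → Adj Es a b → Walk Es b c → Walk Es a c

infixr 5 _∷⟨_⟩_

module _ {n : ℕ} {Es : List (Edge n)} where

  infix 4 _∈W_

  _∈W_ : ∀ {a b} → Fin n → Walk Es a b → Set
  z ∈W [ a ]         = z ≡ a
  z ∈W (a ∷⟨ _ ⟩ w) = z ≡ a ⊎ z ∈W w

  Avoids : ∀ {a b} → Pred (Fin n) 0ℓ → Walk Es a b → Set
  Avoids X w = ∀ z → z ∈W w → ¬ X z

  Meets : ∀ {a b} → Pred (Fin n) 0ℓ → Walk Es a b → Set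
  Meets X w = ∃ λ z → z ∈W w × X z

  start∈ : ∀ {a b} (w : Walk Es a b) → a ∈W w
  start∈ [ a ]         = refl
  start∈ (a ∷⟨ _ ⟩ w) = inj₁ refl

  end∈ : ∀ {a b} (w : Walk Es a b) → b ∈W w
  end∈ [ a ]         = refl
  end∈ (a ∷⟨ _ ⟩ w) = inj₂ (end∈ w)

  _∈W?_ : ∀ {a b} z (w : Walk Es a b) → Dec (z ∈W w)
  z ∈W? [ a ]         = z ≟F a
  z ∈W? (a ∷⟨ _ ⟩ w) = (z ≟F a) ⊎-dec (z ∈W? w)

  meets? : ∀ {a b} {X : Pred (Fin n) 0ℓ} → Decidable X → (w : Walk Es a b) → Dec (Meets X w)
  meets? X? [ a ] with X? a
  ... | yes x = yes (a , refl , x)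
  ... | no ¬x = no λ { (z , refl , x) → ¬x x }
  meets? X? (a ∷⟨ _ ⟩ w) with X? a | meets? X? w
  ... | yes x | _              = yes (a , inj₁ refl , x)
  ... | no _  | yes (z , m , x) = yes (z , inj₂ m , x)
  ... | no ¬x | no ¬m          = no λ { (z , inj₁ refl , x) → ¬x x ; (z , inj₂ m , x) → ¬m (z , m , x) }

  avoids-or-meets : ∀ {a b} {X : Pred (Fin n) 0ℓ} → Decidable X → (w : Walk Es a b) → Avoids X w ⊎ Meets X w
  avoids-or-meets X? w with meets? X? w
  ... | yes m = inj₂ m
  ... | no ¬m = inj₁ λ z z∈ x → ¬m (z , z∈ , x)

  _++W_ : ∀ {a b c} → Walk Es a b → Walk Es b c → Walk Es a c
  [ a ] ++W q          = q
  (a ∷⟨ e ⟩ p) ++W q = a ∷⟨ e ⟩ (p ++W q)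

  ∈-++W⁻ : ∀ {a b c z} (p : Walk Es a b) (q : Walk Es b c) → z ∈W p ++W q → z ∈W p ⊎ z ∈W q
  ∈-++W⁻ [ a ] q m                = inj₂ m
  ∈-++W⁻ (a ∷⟨ e ⟩ p) q (inj₁ x) = inj₁ (inj₁ x)
  ∈-++W⁻ (a ∷⟨ e ⟩ p) q (inj₂ m) = Sum.map₁ inj₂ (∈-++W⁻ p q m)

  ∈-++W⁺ˡ : ∀ {a b c z} (p : Walk Es a b) (q : Walk Es b c) → z ∈W p → z ∈W p ++W q
  ∈-++W⁺ˡ [ a ] q refl            = start∈ q
  ∈-++W⁺ˡ (a ∷⟨ e ⟩ p) q (inj₁ x) = inj₁ x
  ∈-++W⁺ˡ (a ∷⟨ e ⟩ p) q (inj₂ m) = inj₂ (∈-++W⁺ˡ p q m)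

  ∈-++W⁺ʳ : ∀ {a b c z} (p : Walk Es a b) (q : Walk Es b c) → z ∈W q → z ∈W p ++W q
  ∈-++W⁺ʳ [ a ] q m        = m
  ∈-++W⁺ʳ (a ∷⟨ e ⟩ p) q m = inj₂ (∈-++W⁺ʳ p q m)

  avoids-++W : ∀ {a b c} {X : Pred (Fin n) 0ℓ} (p : Walk Es a b) (q : Walk Es b c) →
               Avoids X p → Avoids X q → Avoids X (p ++W q)
  avoids-++W p q avp avq z m with ∈-++W⁻ p q m
  ... | inj₁ m′ = avp z m′
  ... | inj₂ m′ = avq z m′

_⊆W_ : ∀ {n} {E₁ E₂ : List (Edge n)} {a b c d} → Walk E₁ a b → Walk E₂ c d → Set
_⊆W_ {n} p q = ∀ {z : Fin n} → z ∈W p → z ∈W q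

module _ {n : ℕ} {Es : List (Edge n)} where

  prefixTo : ∀ {a b z} (w : Walk Es a b) → z ∈W w → Walk Es a z
  prefixTo [ a ] refl = [ a ]
  prefixTo {z = z} (a ∷⟨ e ⟩ w) m with z ≟F a
  prefixTo (a ∷⟨ e ⟩ w) m        | yes refl = [ a ]
  prefixTo (a ∷⟨ e ⟩ w) (inj₁ x) | no z≢a   = ⊥-elim (z≢a x)
  prefixTo (a ∷⟨ e ⟩ w) (inj₂ m) | no _     = a ∷⟨ e ⟩ prefixTo w m

  prefixTo⊆ : ∀ {a b z} (w : Walk Es a b) (m : z ∈W w) → prefixTo w m ⊆W w
  prefixTo⊆ [ a ] refl y = y
  prefixTo⊆ {z = z} (a ∷⟨ e ⟩ w) m y with z ≟F a
  prefixTo⊆ (a ∷⟨ e ⟩ w) m        y        | yes refl = inj₁ y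
  prefixTo⊆ (a ∷⟨ e ⟩ w) (inj₁ x) y        | no z≢a   = ⊥-elim (z≢a x)
  prefixTo⊆ (a ∷⟨ e ⟩ w) (inj₂ m) (inj₁ x) | no _     = inj₁ x
  prefixTo⊆ (a ∷⟨ e ⟩ w) (inj₂ m) (inj₂ y) | no _     = inj₂ (prefixTo⊆ w m y)

  suffixFrom : ∀ {a b z} (w : Walk Es a b) → z ∈W w → Walk Es z b
  suffixFrom [ a ] refl = [ a ]
  suffixFrom {z = z} (a ∷⟨ e ⟩ w) m with z ≟F a
  suffixFrom (a ∷⟨ e ⟩ w) m        | yes refl = a ∷⟨ e ⟩ w
  suffixFrom (a ∷⟨ e ⟩ w) (inj₁ x) | no z≢a   = ⊥-elim (z≢a x)
  suffixFrom (a ∷⟨ e ⟩ w) (inj₂ m) | no _     = suffixFrom w m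

  suffixFrom⊆ : ∀ {a b z} (w : Walk Es a b) (m : z ∈W w) → suffixFrom w m ⊆W w
  suffixFrom⊆ [ a ] refl y = y
  suffixFrom⊆ {z = z} (a ∷⟨ e ⟩ w) m y with z ≟F a
  suffixFrom⊆ (a ∷⟨ e ⟩ w) m        y | yes refl = y
  suffixFrom⊆ (a ∷⟨ e ⟩ w) (inj₁ x) y | no z≢a   = ⊥-elim (z≢a x)
  suffixFrom⊆ (a ∷⟨ e ⟩ w) (inj₂ m) y | no _     = inj₂ (suffixFrom⊆ w m y)

  data HitsOnlyAtEnd (X : Pred (Fin n) 0ℓ) : ∀ {a b} → Walk Es a b → Set where
    [_] : ∀ a → HitsOnlyAtEnd X [ a ]
    _∷_ : ∀ {a b c} {e : Adj Es a b} {w : Walk Es b c} →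
          ¬ X a → HitsOnlyAtEnd X w → HitsOnlyAtEnd X (a ∷⟨ e ⟩ w)

  HitsOnlyAtStart : ∀ {a b} (X : Pred (Fin n) 0ℓ) → Walk Es a b → Set
  HitsOnlyAtStart X [ a ]         = ⊤
  HitsOnlyAtStart X (a ∷⟨ _ ⟩ w) = Avoids X w

  hitsOnlyAtEnd⇒≡end : ∀ {X a b z} {w : Walk Es a b} → HitsOnlyAtEnd X w → z ∈W w → X z → z ≡ b
  hitsOnlyAtEnd⇒≡end [ a ]       refl     x = refl
  hitsOnlyAtEnd⇒≡end (¬xa ∷ h) (inj₁ refl) x = ⊥-elim (¬xa x)
  hitsOnlyAtEnd⇒≡end (¬xa ∷ h) (inj₂ m)    x = hitsOnlyAtEnd⇒≡end h m x

  hitsOnlyAtStart⇒≡start : ∀ {X a b z} (w : Walk Es a b) → HitsOnlyAtStart X w → z ∈W w → X z → z ≡ a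
  hitsOnlyAtStart⇒≡start [ a ]         h refl     x = refl
  hitsOnlyAtStart⇒≡start (a ∷⟨ e ⟩ w) h (inj₁ eq) x = eq
  hitsOnlyAtStart⇒≡start (a ∷⟨ e ⟩ w) h (inj₂ m)  x = ⊥-elim (h _ m x)

  prefixTo-avoids : ∀ {X a b z} {w : Walk Es a b} → HitsOnlyAtEnd X w → (m : z ∈W w) → ¬ X z →
                    Avoids X (prefixTo w m)
  prefixTo-avoids {w = [ a ]} [ a ] refl ¬xz y refl = ¬xz
  prefixTo-avoids {z = z} {w = a ∷⟨ e ⟩ w} (¬xa ∷ h) m ¬xz y k with z ≟F a
  prefixTo-avoids (¬xa ∷ h) m        ¬xz y refl        | yes refl = ¬xa
  prefixTo-avoids (¬xa ∷ h) (inj₁ x) ¬xz y k           | no z≢a   = ⊥-elim (z≢a x)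
  prefixTo-avoids (¬xa ∷ h) (inj₂ m) ¬xz y (inj₁ refl) | no _     = ¬xa
  prefixTo-avoids (¬xa ∷ h) (inj₂ m) ¬xz y (inj₂ k)    | no _     = prefixTo-avoids h m ¬xz y k

  suffixFrom-avoids : ∀ {X a b z} (w : Walk Es a b) → HitsOnlyAtStart X w → (m : z ∈W w) → ¬ X z →
                      Avoids X (suffixFrom w m)
  suffixFrom-avoids [ a ] h refl ¬xz y refl = ¬xz
  suffixFrom-avoids {z = z} (a ∷⟨ e ⟩ w) h m ¬xz y k with z ≟F a
  suffixFrom-avoids (a ∷⟨ e ⟩ w) h m        ¬xz y (inj₁ refl) | yes refl = ¬xz
  suffixFrom-avoids (a ∷⟨ e ⟩ w) h m        ¬xz y (inj₂ k)    | yes refl = h y k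
  suffixFrom-avoids (a ∷⟨ e ⟩ w) h (inj₁ x) ¬xz y k           | no z≢a   = ⊥-elim (z≢a x)
  suffixFrom-avoids (a ∷⟨ e ⟩ w) h (inj₂ m) ¬xz y k           | no _     = h y (suffixFrom⊆ w m k)

  record FirstHit (X : Pred (Fin n) 0ℓ) {a b} (w : Walk Es a b) : Set where
    constructor firstHitAt
    field
      {hit}  : Fin n
      hit∈X  : X hit
      piece  : Walk Es a hit
      piece⊆ : piece ⊆W w
      clean  : HitsOnlyAtEnd X piece

  record LastHit (X : Pred (Fin n) 0ℓ) {a b} (w : Walk Es a b) : Set where
    constructor lastHitAt
    field
      {hit}  : Fin n
      hit∈X  : X hit
      piece  : Walk Es hit b
      piece⊆ : piece ⊆W w
      clean  : HitsOnlyAtStart X piece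

  firstHit : ∀ {X a b} → Decidable X → (w : Walk Es a b) → Meets X w → FirstHit X w
  firstHit X? [ a ] (z , refl , x) = firstHitAt x [ a ] id [ a ]
  firstHit X? (a ∷⟨ e ⟩ w) h with X? a
  ... | yes x = firstHitAt x [ a ] inj₁ [ a ]
  firstHit X? (a ∷⟨ e ⟩ w) (z , inj₁ refl , x) | no ¬x = ⊥-elim (¬x x)
  firstHit X? (a ∷⟨ e ⟩ w) (z , inj₂ m , x)    | no ¬x with firstHit X? w (z , m , x)
  ... | firstHitAt x′ p p⊆ c = firstHitAt x′ (a ∷⟨ e ⟩ p) Sum.[ inj₁ , inj₂ ∘ p⊆ ] (¬x ∷ c)

  lastHit : ∀ {X a b} → Decidable X → (w : Walk Es a b) → Meets X w → LastHit X w
  lastHit X? [ a ] (z , refl , x) = lastHitAt x [ a ] id tt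
  lastHit X? (a ∷⟨ e ⟩ w) h with meets? X? w
  ... | yes h′ with lastHit X? w h′
  ...   | lastHitAt x′ q q⊆ c = lastHitAt x′ q (inj₂ ∘ q⊆) c
  lastHit X? (a ∷⟨ e ⟩ w) (z , inj₁ refl , x) | no ¬h =
    lastHitAt x (a ∷⟨ e ⟩ w) id λ y m x′ → ¬h (y , m , x′)
  lastHit X? (a ∷⟨ e ⟩ w) (z , inj₂ m , x)    | no ¬h = ⊥-elim (¬h (z , m , x))

  IsPath : ∀ {a b} → Walk Es a b → Set
  IsPath [ a ]         = ⊤
  IsPath (a ∷⟨ _ ⟩ w) = ¬ (a ∈W w) × IsPath w

  suffixFrom-isPath : ∀ {a b z} (w : Walk Es a b) (m : z ∈W w) → IsPath w → IsPath (suffixFrom w m)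
  suffixFrom-isPath [ a ] refl u = tt
  suffixFrom-isPath {z = z} (a ∷⟨ e ⟩ w) m u with z ≟F a
  suffixFrom-isPath (a ∷⟨ e ⟩ w) m        u | yes refl = u
  suffixFrom-isPath (a ∷⟨ e ⟩ w) (inj₁ x) u | no z≢a   = ⊥-elim (z≢a x)
  suffixFrom-isPath (a ∷⟨ e ⟩ w) (inj₂ m) u | no _     = suffixFrom-isPath w m (proj₂ u)

  shortcut : ∀ {a b} (w : Walk Es a b) → Σ (Walk Es a b) λ p → p ⊆W w × IsPath p
  shortcut [ a ] = [ a ] , id , tt
  shortcut (a ∷⟨ e ⟩ w) with shortcut w
  ... | p , p⊆ , pp with a ∈W? p
  ...   | yes m = suffixFrom p m , inj₂ ∘ p⊆ ∘ suffixFrom⊆ p m , suffixFrom-isPath p m pp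
  ...   | no ¬m = a ∷⟨ e ⟩ p , Sum.[ inj₁ , inj₂ ∘ p⊆ ] , ¬m , pp

  ++W-isPath : ∀ {a b c} (p : Walk Es a b) (q : Walk Es b c) → IsPath p → IsPath q →
               (∀ {z} → z ∈W p → z ∈W q → z ≡ b) → IsPath (p ++W q)
  ++W-isPath [ a ] q _ pq _ = pq
  ++W-isPath (a ∷⟨ e ⟩ p) q (a∉p , pp) pq meet = a∉p++q , ++W-isPath p q pp pq (meet ∘ inj₂)
    where
    a∉p++q : ¬ (a ∈W p ++W q)
    a∉p++q m with ∈-++W⁻ p q m
    ... | inj₁ a∈p = a∉p a∈p
    ... | inj₂ a∈q = a∉p (subst (_∈W p) (sym (meet (inj₁ refl) a∈q)) (end∈ p))

  toList : ∀ {a b} → Walk Es a b → List (Fin n)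
  toList [ a ]         = a ∷ []
  toList (a ∷⟨ _ ⟩ w) = a ∷ toList w

  toList-∈⁺ : ∀ {a b z} (w : Walk Es a b) → z ∈W w → z ∈ₗ toList w
  toList-∈⁺ [ a ]         refl     = here refl
  toList-∈⁺ (a ∷⟨ _ ⟩ w) (inj₁ x) = here x
  toList-∈⁺ (a ∷⟨ _ ⟩ w) (inj₂ m) = there (toList-∈⁺ w m)

  toList-∈⁻ : ∀ {a b z} (w : Walk Es a b) → z ∈ₗ toList w → z ∈W w
  toList-∈⁻ [ a ]         (here x)  = x
  toList-∈⁻ (a ∷⟨ _ ⟩ w) (here x)  = inj₁ x
  toList-∈⁻ (a ∷⟨ _ ⟩ w) (there m) = inj₂ (toList-∈⁻ w m)

  toList-unique : ∀ {a b} (w : Walk Es a b) → IsPath w → Unique (toList w)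
  toList-unique [ a ]         _          = [] ∷ []
  toList-unique (a ∷⟨ _ ⟩ w) (a∉w , pw) =
    All.tabulate (λ m a≡ → a∉w (subst (_∈W w) (sym a≡) (toList-∈⁻ w m))) ∷ toList-unique w pw

  toList-head : ∀ {a b} (w : Walk Es a b) → head (toList w) ≡ just a
  toList-head [ a ]         = refl
  toList-head (a ∷⟨ _ ⟩ w) = refl

  toList-∷ : ∀ {a b} (w : Walk Es a b) → ∃ λ r → toList w ≡ a ∷ r
  toList-∷ [ a ]         = [] , refl
  toList-∷ (a ∷⟨ _ ⟩ w) = toList w , refl

  toList-last : ∀ {a b} (w : Walk Es a b) → last (toList w) ≡ just b
  toList-last [ a ] = refl
  toList-last (a ∷⟨ _ ⟩ w) with toList-∷ w | toList-last w
  ... | r , eq | l rewrite eq = l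

  toList-nonempty : ∀ {a b} (w : Walk Es a b) → toList w ≢ []
  toList-nonempty [ a ]         ()
  toList-nonempty (a ∷⟨ _ ⟩ w) ()

  toList-linked : ∀ {a b} {R : Fin n → Fin n → Set} → (∀ {u v} → Adj Es u v → R u v) →
                  (w : Walk Es a b) → Linked R (toList w)
  toList-linked f [ a ] = [-]
  toList-linked f (a ∷⟨ e ⟩ w) with toList-∷ w | toList-linked f w
  ... | r , eq | l rewrite eq = f e ∷ l

mapW : ∀ {n} {E₁ E₂ : List (Edge n)} → (∀ {u v} → Adj E₁ u v → Adj E₂ u v) →
       ∀ {a b} → Walk E₁ a b → Walk E₂ a b
mapW f [ a ]         = [ a ]
mapW f (a ∷⟨ e ⟩ w) = a ∷⟨ f e ⟩ mapW f w

mapW-⊆ : ∀ {n} {E₁ E₂ : List (Edge n)} (f : ∀ {u v} → Adj E₁ u v → Adj E₂ u v) →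
         ∀ {a b} (w : Walk E₁ a b) → mapW f w ⊆W w
mapW-⊆ f [ a ]         m        = m
mapW-⊆ f (a ∷⟨ e ⟩ w) (inj₁ x) = inj₁ x
mapW-⊆ f (a ∷⟨ e ⟩ w) (inj₂ m) = inj₂ (mapW-⊆ f w m)

unique⇒length≤∣X∣ : ∀ {n} (X : Subset n) (xs : List (Fin n)) → Unique xs → All (_∈ X) xs → length xs ≤ ∣ X ∣
unique⇒length≤∣X∣ X []       _          _          = z≤n
unique⇒length≤∣X∣ X (x ∷ xs) (x∉ ∷ xs!) (x∈ ∷ xs∈) =
  ≤-trans (s≤s (unique⇒length≤∣X∣ (X - x) xs xs! (All.zipWith inRest (x∉ , xs∈)))) (x∈p⇒∣p-x∣<∣p∣ x∈)
  where
  inRest : ∀ {y} → x ≢ y × y ∈ X → y ∈ X - x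
  inRest (x≢y , y∈) = x∈p∧x≢y⇒x∈p-y y∈ (x≢y ∘ sym)

∣p∪q∣≤∣p∣+∣q∣ : ∀ {n} (p q : Subset n) → ∣ p ∪ q ∣ ≤ ∣ p ∣ + ∣ q ∣
∣p∪q∣≤∣p∣+∣q∣ []            []            = z≤n
∣p∪q∣≤∣p∣+∣q∣ (outside ∷ p) (outside ∷ q) = ∣p∪q∣≤∣p∣+∣q∣ p q
∣p∪q∣≤∣p∣+∣q∣ (outside ∷ p) (inside ∷ q)  = ≤-trans (s≤s (∣p∪q∣≤∣p∣+∣q∣ p q)) (≤-reflexive (sym (+-suc ∣ p ∣ ∣ q ∣)))
∣p∪q∣≤∣p∣+∣q∣ (inside ∷ p)  (outside ∷ q) = s≤s (∣p∪q∣≤∣p∣+∣q∣ p q)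
∣p∪q∣≤∣p∣+∣q∣ (inside ∷ p)  (inside ∷ q)  = s≤s (≤-trans (∣p∪q∣≤∣p∣+∣q∣ p q) (+-monoʳ-≤ ∣ p ∣ (n≤1+n _)))

∣p∪⁅x⁆∣≤1+∣p∣ : ∀ {n} (p : Subset n) x → ∣ p ∪ ⁅ x ⁆ ∣ ≤ suc ∣ p ∣
∣p∪⁅x⁆∣≤1+∣p∣ p x = begin
  ∣ p ∪ ⁅ x ⁆ ∣       ≤⟨ ∣p∪q∣≤∣p∣+∣q∣ p ⁅ x ⁆ ⟩
  ∣ p ∣ + ∣ ⁅ x ⁆ ∣   ≡⟨ cong (∣ p ∣ +_) (∣⁅x⁆∣≡1 x) ⟩
  ∣ p ∣ + 1           ≡⟨ +-comm ∣ p ∣ 1 ⟩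
  suc ∣ p ∣           ∎
  where open ≤-Reasoning

∣p∪⁅x⁆∣≤∣p∣ : ∀ {n} (p : Subset n) {x} → x ∈ p → ∣ p ∪ ⁅ x ⁆ ∣ ≤ ∣ p ∣
∣p∪⁅x⁆∣≤∣p∣ p {x} x∈p = p⊆q⇒∣p∣≤∣q∣ λ m → Sum.[ id , (λ y∈⁅x⁆ → subst (_∈ p) (sym (x∈⁅y⁆⇒x≡y x y∈⁅x⁆)) x∈p) ] (x∈p∪q⁻ p ⁅ x ⁆ m)

elements : ∀ {n} (X : Subset n) → Σ (List (Fin n)) λ xs → Unique xs × All (_∈ X) xs × length xs ≡ ∣ X ∣
elements [] = [] , [] , [] , refl
elements (s ∷ p) with elements p
... | xs , xs! , xs∈ , len = withHead s
  where
  tail : List (Fin _)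
  tail = map F.suc xs
  tail! : Unique tail
  tail! = Unique.map⁺ Fin-suc-injective xs!
  tail∈ : ∀ {s} → All (_∈ s ∷ p) tail
  tail∈ = AllP.map⁺ (All.map ∈-tail xs∈)
  tail-len : length tail ≡ ∣ p ∣
  tail-len = trans (length-map F.suc xs) len
  withHead : ∀ s → Σ (List (Fin _)) λ ys → Unique ys × All (_∈ s ∷ p) ys × length ys ≡ ∣ s ∷ p ∣
  withHead outside = tail , tail! , tail∈ , tail-len
  withHead inside  = zero ∷ tail , AllP.map⁺ (All.universal (λ _ ()) xs) ∷ tail! ,
                     ∈-head ∷ tail∈ , cong suc tail-len

takeFin : ∀ {A : Set} {k} (xs : List A) → k ≤ length xs → Fin k → A
takeFin (x ∷ xs) (s≤s _)  zero    = x
takeFin (x ∷ xs) (s≤s le) (suc r) = takeFin xs le r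

takeFin-all : ∀ {A : Set} {P : A → Set} {k} (xs : List A) (le : k ≤ length xs) → All P xs → ∀ r → P (takeFin xs le r)
takeFin-all (x ∷ xs) (s≤s _)  (px ∷ _)   zero    = px
takeFin-all (x ∷ xs) (s≤s le) (_  ∷ pxs) (suc r) = takeFin-all xs le pxs r

takeFin-injective : ∀ {A : Set} {k} (xs : List A) (le : k ≤ length xs) → Unique xs →
                    ∀ {r s} → takeFin xs le r ≡ takeFin xs le s → r ≡ s
takeFin-injective (x ∷ xs) (s≤s le) _          {zero}  {zero}  _  = refl
takeFin-injective (x ∷ xs) (s≤s le) (x∉ ∷ _)   {zero}  {suc s} eq = ⊥-elim (takeFin-all xs le x∉ s eq)
takeFin-injective (x ∷ xs) (s≤s le) (x∉ ∷ _)   {suc r} {zero}  eq = ⊥-elim (takeFin-all xs le x∉ r (sym eq))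
takeFin-injective (x ∷ xs) (s≤s le) (_  ∷ xs!) {suc r} {suc s} eq = cong suc (takeFin-injective xs le xs! eq)

Injection : ∀ {n} → ℕ → Subset n → Set
Injection {n} k X = Σ (Fin k → Fin n) λ g → (∀ r → g r ∈ X) × (∀ {r s} → g r ≡ g s → r ≡ s)

pickDistinct : ∀ {n k} (X : Subset n) → k ≤ ∣ X ∣ → Injection k X
pickDistinct X k≤ with elements X
... | xs , xs! , xs∈ , len = takeFin xs le , takeFin-all xs le xs∈ , takeFin-injective xs le xs!
  where le = ≤-trans k≤ (≤-reflexive (sym len))

injection-onto : ∀ {n k} (X : Subset n) → ∣ X ∣ ≤ k → ((g , _) : Injection k X) → ∀ {x} → x ∈ X → ∃ λ r → g r ≡ x
injection-onto {k = k} X ∣X∣≤k (g , g∈ , g-inj) {x} x∈ with any? (λ r → g r ≟F x)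
... | yes hit = hit
... | no miss = ⊥-elim (<-irrefl refl (≤-trans tooMany ∣X∣≤k))
  where
  tooMany : suc k ≤ ∣ X ∣
  tooMany = ≤-trans (≤-reflexive (cong suc (sym (length-tabulate g))))
              (unique⇒length≤∣X∣ X (x ∷ tabulate g)
                (AllP.tabulate⁺ (λ r x≡ → miss (r , sym x≡)) ∷ Unique.tabulate⁺ g-inj)
                (x∈ ∷ AllP.tabulate⁺ g∈))

subsetOf : ∀ {n} {P : Pred (Fin n) 0ℓ} → Decidable P → Subset n
subsetOf {zero}  P? = []
subsetOf {suc n} P? = does (P? zero) ∷ subsetOf (P? ∘ suc)

subsetOf⁺ : ∀ {n} {P : Pred (Fin n) 0ℓ} (P? : Decidable P) {i} → P i → i ∈ subsetOf P?
subsetOf⁺ {suc n} P? {zero} p with P? zero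
... | yes _ = ∈-head
... | no ¬p = ⊥-elim (¬p p)
subsetOf⁺ {suc n} P? {suc i} p = ∈-tail (subsetOf⁺ (P? ∘ suc) p)

subsetOf⁻ : ∀ {n} {P : Pred (Fin n) 0ℓ} (P? : Decidable P) {i} → i ∈ subsetOf P? → P i
subsetOf⁻ {suc n} P? {zero} m with P? zero
subsetOf⁻ {suc n} P? {zero} m  | yes p = p
subsetOf⁻ {suc n} P? {zero} () | no _
subsetOf⁻ {suc n} P? {suc i} (∈-tail m) = subsetOf⁻ (P? ∘ suc) m

module _ {n : ℕ} {Es : List (Edge n)} where

  lengthW : ∀ {a b} → Walk Es a b → ℕ
  lengthW [ a ]         = zero
  lengthW (a ∷⟨ _ ⟩ w) = suc (lengthW w)

  length-toList : ∀ {a b} (w : Walk Es a b) → length (toList w) ≡ suc (lengthW w)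
  length-toList [ a ]         = refl
  length-toList (a ∷⟨ _ ⟩ w) = cong suc (length-toList w)

  isPath⇒lengthW<n : ∀ {a b} (w : Walk Es a b) → IsPath w → lengthW w < n
  isPath⇒lengthW<n w pw = begin-strict
    lengthW w              <⟨ n<1+n _ ⟩
    suc (lengthW w)        ≡⟨ length-toList w ⟨
    length (toList w)      ≤⟨ unique⇒length≤∣X∣ full (toList w) (toList-unique w pw) (All.universal (λ _ → ∈⊤) _) ⟩
    ∣ full {n} ∣            ≡⟨ ∣⊤∣≡n n ⟩
    n                      ∎
    where open ≤-Reasoning

record AvoidingWalk {n} (Es : List (Edge n)) (A B X : Pred (Fin n) 0ℓ) : Set where
  constructor avoidingWalk
  field
    {from to} : Fin n
    from∈A    : A from
    to∈B      : B to
    walk      : Walk Es from to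
    avoids    : Avoids X walk

Separates : ∀ {n} → List (Edge n) → (A B : Pred (Fin n) 0ℓ) → Subset n → Set
Separates Es A B S = ∀ {a b} → A a → B b → (w : Walk Es a b) → Meets (_∈ S) w

module _ {n : ℕ} {Es : List (Edge n)} {A B : Pred (Fin n) 0ℓ} where

  separates : ∀ S → ¬ AvoidingWalk Es A B (_∈ S) → Separates Es A B S
  separates S none a∈A b∈B w with avoids-or-meets (_∈S? S) w
  ... | inj₁ av = ⊥-elim (none (avoidingWalk a∈A b∈B w av))
  ... | inj₂ m  = m

  separates⇒¬avoidingWalk : ∀ {S} → Separates Es A B S → ¬ AvoidingWalk Es A B (_∈ S)
  separates⇒¬avoidingWalk sep (avoidingWalk a∈A b∈B w av) with sep a∈A b∈B w
  ... | z , z∈w , z∈S = av z z∈w z∈S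

module Reachability {n : ℕ} (Es : List (Edge n)) where
  open DecMem (≡-dec (_≟F_ {n}) (_≟F_ {n})) using () renaming (_∈?_ to _∈E?_)

  adj? : ∀ u v → Dec (Adj Es u v)
  adj? u v = ((u , v) ∈E? Es) ⊎-dec ((v , u) ∈E? Es)

  module _ {B X : Pred (Fin n) 0ℓ} (B? : Decidable B) (X? : Decidable X) where

    ReachesIn : ℕ → Fin n → Set
    ReachesIn zero    z = B z × ¬ X z
    ReachesIn (suc m) z = ReachesIn m z ⊎ (¬ X z × ∃ λ y → Adj Es z y × ReachesIn m y)

    reachesIn? : ∀ m z → Dec (ReachesIn m z)
    reachesIn? zero    z = B? z ×-dec ¬? (X? z)
    reachesIn? (suc m) z = reachesIn? m z ⊎-dec (¬? (X? z) ×-dec any? (λ y → adj? z y ×-dec reachesIn? m y))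

    reachesIn-sound : ∀ m z → ReachesIn m z → Σ (Fin n) λ b → B b × Σ (Walk Es z b) (Avoids X)
    reachesIn-sound zero    z (b∈B , ¬xz) = z , b∈B , [ z ] , λ { y refl → ¬xz }
    reachesIn-sound (suc m) z (inj₁ r) = reachesIn-sound m z r
    reachesIn-sound (suc m) z (inj₂ (¬xz , y , e , r)) with reachesIn-sound m y r
    ... | b , b∈B , w , av = b , b∈B , z ∷⟨ e ⟩ w , λ { y′ (inj₁ refl) → ¬xz ; y′ (inj₂ k) → av y′ k }

    reachesIn-mono : ∀ {m m′} z → m ≤ m′ → ReachesIn m z → ReachesIn m′ z
    reachesIn-mono {m′ = zero}   z z≤n r = r
    reachesIn-mono {zero} {suc m′} z z≤n r = inj₁ (reachesIn-mono z z≤n r)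
    reachesIn-mono {suc m} {suc m′} z (s≤s le) (inj₁ r) = inj₁ (reachesIn-mono z le r)
    reachesIn-mono {suc m} {suc m′} z (s≤s le) (inj₂ (¬xz , y , e , r)) = inj₂ (¬xz , y , e , reachesIn-mono y le r)

    reachesIn-complete : ∀ {z b} (w : Walk Es z b) → B b → Avoids X w → ReachesIn (lengthW w) z
    reachesIn-complete [ z ]          b∈B av = b∈B , av z refl
    reachesIn-complete (z ∷⟨ e ⟩ w) b∈B av =
      inj₂ (av z (inj₁ refl) , _ , e , reachesIn-complete w b∈B (λ y k → av y (inj₂ k)))

  -- Existence of an A–B walk avoiding X is decidable: shortcut to a path,
  -- whose length is below n.
  avoidingWalk? : ∀ {A B X : Pred (Fin n) 0ℓ} → Decidable A → Decidable B → Decidable X → Dec (AvoidingWalk Es A B X)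
  avoidingWalk? {A} {B} {X} A? B? X? with any? (λ a → A? a ×-dec reachesIn? B? X? n a)
  ... | yes (a , a∈A , r) with reachesIn-sound B? X? n a r
  ...   | b , b∈B , w , av = yes (avoidingWalk a∈A b∈B w av)
  avoidingWalk? {A} {B} {X} A? B? X? | no none = no λ (avoidingWalk a∈A b∈B w av) → none (_ , a∈A , reaches w b∈B av)
    where
    reaches : ∀ {a b} (w : Walk Es a b) → B b → Avoids X w → ReachesIn B? X? n a
    reaches w b∈B av with shortcut w
    ... | p , p⊆ , pp = reachesIn-mono B? X? _ (<⇒≤ (isPath⇒lengthW<n p pp))
                          (reachesIn-complete B? X? p b∈B (λ y k → av y (p⊆ k)))

  separates? : ∀ {A B : Pred (Fin n) 0ℓ} → Decidable A → Decidable B → ∀ S → Dec (Separates Es A B S)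
  separates? A? B? S with avoidingWalk? A? B? (_∈S? S)
  ... | yes aw = no λ sep → separates⇒¬avoidingWalk sep aw
  ... | no ¬aw = yes (separates S ¬aw)

-- Menger's theorem, proved by induction on the number of edges.

SeparatorBound : ∀ {n} → List (Edge n) → (A B : Pred (Fin n) 0ℓ) → ℕ → Set
SeparatorBound Es A B k = ∀ S → Separates Es A B S → k ≤ ∣ S ∣

record ABWalk {n} (Es : List (Edge n)) (A B : Pred (Fin n) 0ℓ) : Set where
  constructor abWalk
  field
    {from to} : Fin n
    from∈A    : A from
    to∈B      : B to
    walk      : Walk Es from to
open ABWalk

DisjointW : ∀ {n} {E₁ E₂ : List (Edge n)} {a b c d} → Walk E₁ a b → Walk E₂ c d → Set
DisjointW p q = ∀ {z} → z ∈W p → z ∈W q → ⊥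

Linkage : ∀ {n} → List (Edge n) → (A B : Pred (Fin n) 0ℓ) → ℕ → Set
Linkage Es A B k = Σ (Fin k → ABWalk Es A B) λ F → ∀ {r s} → r ≢ s → DisjointW (walk (F r)) (walk (F s))

linkage-injective : ∀ {n} {Es : List (Edge n)} {A B k} ((F , disjoint) : Linkage Es A B k) (c : Fin k → Fin n) →
                    (∀ r → c r ∈W walk (F r)) → ∀ {r s} → c r ≡ c s → r ≡ s
linkage-injective (F , disjoint) c c∈ {r} {s} eq with r ≟F s
... | yes r≡s = r≡s
... | no r≢s  = ⊥-elim (disjoint r≢s (c∈ r) (subst (_∈W walk (F s)) (sym eq) (c∈ s)))

weakenAdj : ∀ {n} {e : Edge n} {Es : List (Edge n)} {u v} → Adj Es u v → Adj (e ∷ Es) u v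
weakenAdj = Sum.map there there

EndOf : ∀ {n} → Fin n → Fin n → Fin n → Set
EndOf x y z = z ≡ x ⊎ z ≡ y

module _ {n : ℕ} {x y : Fin n} {Es′ : List (Edge n)} where

  adj-∷ : ∀ {a b} → Adj ((x , y) ∷ Es′) a b → Adj Es′ a b ⊎ (EndOf x y a × EndOf x y b)
  adj-∷ (inj₁ (here refl))  = inj₂ (inj₁ refl , inj₂ refl)
  adj-∷ (inj₂ (here refl))  = inj₂ (inj₂ refl , inj₁ refl)
  adj-∷ (inj₁ (there m))    = inj₁ (inj₁ m)
  adj-∷ (inj₂ (there m))    = inj₁ (inj₂ m)

  data EdgeSplit {a b} (w : Walk ((x , y) ∷ Es′) a b) : Set where
    avoidsEdge : (w′ : Walk Es′ a b) → w′ ⊆W w → EdgeSplit w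
    usesEdge   : ∀ {z z′} → EndOf x y z → (p : Walk Es′ a z) → p ⊆W w →
                 EndOf x y z′ → (q : Walk Es′ z′ b) → q ⊆W w → EdgeSplit w

  edgeSplit : ∀ {a b} (w : Walk ((x , y) ∷ Es′) a b) → EdgeSplit w
  edgeSplit [ a ] = avoidsEdge [ a ] id
  edgeSplit (a ∷⟨ e ⟩ w) with adj-∷ e | edgeSplit w
  ... | inj₁ e′ | avoidsEdge w′ w′⊆ = avoidsEdge (a ∷⟨ e′ ⟩ w′) (Sum.map₂ w′⊆)
  ... | inj₁ e′ | usesEdge ez p p⊆ ez′ q q⊆ = usesEdge ez (a ∷⟨ e′ ⟩ p) (Sum.map₂ p⊆) ez′ q (inj₂ ∘ q⊆)
  ... | inj₂ (ea , eb) | avoidsEdge w′ w′⊆ = usesEdge ea [ a ] inj₁ eb w′ (inj₂ ∘ w′⊆)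
  ... | inj₂ (ea , eb) | usesEdge _ _ _ ez′ q q⊆ = usesEdge ea [ a ] inj₁ ez′ q (inj₂ ∘ q⊆)

-- With no edges, the vertices in A ∩ B form an A–B separator, and any k of them
-- are k disjoint trivial walks.
menger-noEdges : ∀ {n} (k : ℕ) {A B : Pred (Fin n) 0ℓ} → Decidable A → Decidable B →
                 SeparatorBound [] A B k → Linkage [] A B k
menger-noEdges {n} k {A} {B} A? B? bound = (λ r → abWalk (proj₁ (inAB r)) (proj₂ (inAB r)) [ g r ]) , disjoint
  where
  AB? : Decidable (λ z → A z × B z)
  AB? z = A? z ×-dec B? z
  sepAB : Separates [] A B (subsetOf AB?)
  sepAB a∈A b∈B [ a ]                = a , refl , subsetOf⁺ AB? (a∈A , b∈B)
  sepAB a∈A b∈B (a ∷⟨ inj₁ () ⟩ _)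
  sepAB a∈A b∈B (a ∷⟨ inj₂ () ⟩ _)
  picked : Injection k (subsetOf AB?)
  picked = pickDistinct (subsetOf AB?) (bound _ sepAB)
  g : Fin k → Fin n
  g = proj₁ picked
  inAB : ∀ r → A (g r) × B (g r)
  inAB r = subsetOf⁻ AB? (proj₁ (proj₂ picked) r)
  disjoint : ∀ {r s} → r ≢ s → DisjointW {E₁ = []} {E₂ = []} [ g r ] [ g s ]
  disjoint r≢s refl eq = r≢s (proj₂ (proj₂ picked) eq)

-- The induction step: the edge xy is added to Es′, in which some set S of fewer
-- than k vertices separates A from B.  Exactly one end u of xy is reachable from A
-- avoiding S; S+u and S+v are then A–B separators of size k, and k disjoint
-- A–(S+u) and (S+v)–B walks in Es′ (induction hypothesis) glue, along the
-- matching S+u → S+v fixing S and sending u to v, into k disjoint A–B walks.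
module MengerStep {n : ℕ} (x y : Fin n) (Es′ : List (Edge n)) (k : ℕ)
  (IH : ∀ {A B} → Decidable A → Decidable B → SeparatorBound Es′ A B k → Linkage Es′ A B k)
  {A B : Pred (Fin n) 0ℓ} (A? : Decidable A) (B? : Decidable B)
  (bound : SeparatorBound ((x , y) ∷ Es′) A B k)
  (S : Subset n) (sepS : Separates Es′ A B S) (small : suc ∣ S ∣ ≤ k) where

  Es : List (Edge n)
  Es = (x , y) ∷ Es′

  noShortcut : ∀ {a b} → A a → B b → (w : Walk Es′ a b) → ¬ Avoids (_∈ S) w
  noShortcut a∈A b∈B w av = separates⇒¬avoidingWalk sepS (avoidingWalk a∈A b∈B w av)

  ¬separatesS : ¬ AvoidingWalk Es A B (_∈ S) → ⊥
  ¬separatesS none = <-irrefl refl (≤-trans small (bound S (separates S none)))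

  Reached : Fin n → Set
  Reached z = AvoidingWalk Es′ A (_≡ z) (_∈ S)

  -- An A–B walk avoiding S in Es, through an end reached from A, yields one in Es′.
  viaReached : ∀ {z b} → Reached z → B b → (q : Walk Es′ z b) → Avoids (_∈ S) q → ⊥
  viaReached (avoidingWalk a∈A refl r avr) b∈B q avq = noShortcut a∈A b∈B (r ++W q) (avoids-++W r q avr avq)

  notBoth : Reached x → Reached y → ⊥
  notBoth rx ry = ¬separatesS λ (avoidingWalk a∈A b∈B w av) → go a∈A b∈B (edgeSplit w) av
    where
    reached : ∀ {z} → EndOf x y z → Reached z
    reached (inj₁ refl) = rx
    reached (inj₂ refl) = ry
    go : ∀ {a b} {w : Walk Es a b} → A a → B b → EdgeSplit w → Avoids (_∈ S) w → ⊥
    go a∈A b∈B (avoidsEdge w′ w′⊆)         av = noShortcut a∈A b∈B w′ (λ z m → av z (w′⊆ m))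
    go a∈A b∈B (usesEdge _ _ _ ez′ q q⊆) av = viaReached (reached ez′) b∈B q (λ z m → av z (q⊆ m))

  notNeither : ¬ Reached x → ¬ Reached y → ⊥
  notNeither nx ny = ¬separatesS λ (avoidingWalk a∈A b∈B w av) → go a∈A b∈B (edgeSplit w) av
    where
    unreached : ∀ {z} → EndOf x y z → ¬ Reached z
    unreached (inj₁ refl) = nx
    unreached (inj₂ refl) = ny
    go : ∀ {a b} {w : Walk Es a b} → A a → B b → EdgeSplit w → Avoids (_∈ S) w → ⊥
    go a∈A b∈B (avoidsEdge w′ w′⊆)        av = noShortcut a∈A b∈B w′ (λ z m → av z (w′⊆ m))
    go a∈A b∈B (usesEdge ez p p⊆ _ _ _) av = unreached ez (avoidingWalk a∈A refl p (λ z m → av z (p⊆ m)))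

  module Rematch (u v : Fin n) (uv : Adj Es u v) (ru : Reached u) (nv : ¬ Reached v)
                 (ends : ∀ {z} → EndOf x y z → z ≡ u ⊎ z ≡ v) where

    SA SB : Subset n
    SA = S ∪ ⁅ u ⁆
    SB = S ∪ ⁅ v ⁆

    S⊆SA : ∀ {z} → z ∈ S → z ∈ SA
    S⊆SA = x∈p∪q⁺ ∘ inj₁
    S⊆SB : ∀ {z} → z ∈ S → z ∈ SB
    S⊆SB = x∈p∪q⁺ ∘ inj₁
    u∈SA : u ∈ SA
    u∈SA = x∈p∪q⁺ (inj₂ (x∈⁅x⁆ u))
    v∈SB : v ∈ SB
    v∈SB = x∈p∪q⁺ (inj₂ (x∈⁅x⁆ v))
    SA-cases : ∀ {z} → z ∈ SA → z ∈ S ⊎ z ≡ u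
    SA-cases m = Sum.map₂ (x∈⁅y⁆⇒x≡y u) (x∈p∪q⁻ S ⁅ u ⁆ m)
    SB-cases : ∀ {z} → z ∈ SB → z ∈ S ⊎ z ≡ v
    SB-cases m = Sum.map₂ (x∈⁅y⁆⇒x≡y v) (x∈p∪q⁻ S ⁅ v ⁆ m)

    -- The part of an A–B walk of Es before its first use of xy is a walk in Es′
    -- meeting S+u: it meets S, or ends in u, or ends in v without being able to
    -- avoid S.
    initialMeetsSA : ∀ {a b} → A a → B b → (w : Walk Es a b) →
                     ∃ λ z → Σ (Walk Es′ a z) λ p → p ⊆W w × Meets (_∈ SA) p
    initialMeetsSA a∈A b∈B w with edgeSplit w
    ... | avoidsEdge w′ w′⊆ = let (z , m , z∈S) = sepS a∈A b∈B w′ in _ , w′ , w′⊆ , z , m , S⊆SA z∈S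
    ... | usesEdge ez p p⊆ _ _ _ with ends ez
    ...   | inj₁ refl = _ , p , p⊆ , u , end∈ p , u∈SA
    ...   | inj₂ refl with avoids-or-meets (_∈S? S) p
    ...     | inj₁ av = ⊥-elim (nv (avoidingWalk a∈A refl p av))
    ...     | inj₂ (z , m , z∈S) = _ , p , p⊆ , z , m , S⊆SA z∈S

    -- Dually, the part after its last use of xy meets S+v.
    finalMeetsSB : ∀ {a b} → A a → B b → (w : Walk Es a b) →
                   ∃ λ z → Σ (Walk Es′ z b) λ q → q ⊆W w × Meets (_∈ SB) q
    finalMeetsSB a∈A b∈B w with edgeSplit w
    ... | avoidsEdge w′ w′⊆ = let (z , m , z∈S) = sepS a∈A b∈B w′ in _ , w′ , w′⊆ , z , m , S⊆SB z∈S
    ... | usesEdge _ _ _ ez′ q q⊆ with ends ez′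
    ...   | inj₂ refl = _ , q , q⊆ , v , start∈ q , v∈SB
    ...   | inj₁ refl with avoids-or-meets (_∈S? S) q
    ...     | inj₁ av = ⊥-elim (viaReached ru b∈B q av)
    ...     | inj₂ (z , m , z∈S) = _ , q , q⊆ , z , m , S⊆SB z∈S

    separatesSA : Separates Es A B SA
    separatesSA a∈A b∈B w = let (_ , p , p⊆ , z , m , z∈SA) = initialMeetsSA a∈A b∈B w in z , p⊆ m , z∈SA

    separatesSB : Separates Es A B SB
    separatesSB a∈A b∈B w = let (_ , q , q⊆ , z , m , z∈SB) = finalMeetsSB a∈A b∈B w in z , q⊆ m , z∈SB

    ∣SB∣≤k : ∣ SB ∣ ≤ k
    ∣SB∣≤k = ≤-trans (∣p∪⁅x⁆∣≤1+∣p∣ S v) small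

    u∉S : u ∉ S
    u∉S u∈S = <-irrefl refl (≤-trans small (≤-trans (bound SA separatesSA) (∣p∪⁅x⁆∣≤∣p∣ S u∈S)))

    v∉S : v ∉ S
    v∉S v∈S = <-irrefl refl (≤-trans small (≤-trans (bound SB separatesSB) (∣p∪⁅x⁆∣≤∣p∣ S v∈S)))

    -- An A–(S+u) separator in Es′ separates A from B in Es, hence is large.
    boundA : SeparatorBound Es′ A (_∈ SA) k
    boundA T sepT = bound T λ a∈A b∈B w →
      let (_ , p , p⊆ , z , m , z∈SA) = initialMeetsSA a∈A b∈B w
          (t , t∈ , t∈T) = sepT a∈A z∈SA (prefixTo p m)
      in t , p⊆ (prefixTo⊆ p m t∈) , t∈T

    boundB : SeparatorBound Es′ (_∈ SB) B k
    boundB T sepT = bound T λ a∈A b∈B w →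
      let (_ , q , q⊆ , z , m , z∈SB) = finalMeetsSB a∈A b∈B w
          (t , t∈ , t∈T) = sepT z∈SB b∈B (suffixFrom q m)
      in t , q⊆ (suffixFrom⊆ q m t∈) , t∈T

    linkA : Linkage Es′ A (_∈ SA) k
    linkA = IH A? (_∈S? SA) boundA

    linkB : Linkage Es′ (_∈ SB) B k
    linkB = IH (_∈S? SB) B? boundB

    abstract
      trimA : (r : Fin k) → FirstHit (_∈ SA) (walk (proj₁ linkA r))
      trimA r = firstHit (_∈S? SA) (walk (proj₁ linkA r)) (_ , end∈ _ , to∈B (proj₁ linkA r))

      trimB : (r : Fin k) → LastHit (_∈ SB) (walk (proj₁ linkB r))
      trimB r = lastHit (_∈S? SB) (walk (proj₁ linkB r)) (_ , start∈ _ , from∈A (proj₁ linkB r))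

    endA : Fin k → Fin n
    endA r = FirstHit.hit (trimA r)

    startB : Fin k → Fin n
    startB r = LastHit.hit (trimB r)

    pieceA : ∀ r → Walk Es′ (from (proj₁ linkA r)) (endA r)
    pieceA r = FirstHit.piece (trimA r)

    pieceB : ∀ r → Walk Es′ (startB r) (to (proj₁ linkB r))
    pieceB r = LastHit.piece (trimB r)

    endA-injective : ∀ {r s} → endA r ≡ endA s → r ≡ s
    endA-injective = linkage-injective linkA endA (λ r → FirstHit.piece⊆ (trimA r) (end∈ (pieceA r)))

    startB-injective : ∀ {r s} → startB r ≡ startB s → r ≡ s
    startB-injective = linkage-injective linkB startB (λ r → LastHit.piece⊆ (trimB r) (start∈ (pieceB r)))

    Matched : Fin n → Fin n → Set
    Matched z z′ = (z ≡ z′ × z ∈ S) ⊎ (z ≡ u × z′ ≡ v)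

    match : ∀ {z} → z ∈ SA → ∃ λ z′ → z′ ∈ SB × Matched z z′
    match {z} z∈SA with z ∈S? S | SA-cases z∈SA
    ... | yes z∈S | _         = z , S⊆SB z∈S , inj₁ (refl , z∈S)
    ... | no z∉S  | inj₁ z∈S  = ⊥-elim (z∉S z∈S)
    ... | no _    | inj₂ z≡u  = v , v∈SB , inj₂ (z≡u , refl)

    matched-injective : ∀ {z z′ w w′} → Matched z w → Matched z′ w′ → w ≡ w′ → z ≡ z′
    matched-injective (inj₁ (refl , _))   (inj₁ (refl , _))   eq = eq
    matched-injective (inj₁ (refl , z∈S)) (inj₂ (_ , refl))   eq = ⊥-elim (v∉S (subst (_∈ S) eq z∈S))
    matched-injective (inj₂ (_ , refl))   (inj₁ (refl , z∈S)) eq = ⊥-elim (v∉S (subst (_∈ S) (sym eq) z∈S))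
    matched-injective (inj₂ (refl , _))   (inj₂ (refl , _))   _  = refl

    abstract
      matchedEnd : ∀ r → ∃ λ z′ → z′ ∈ SB × Matched (endA r) z′
      matchedEnd r = match (FirstHit.hit∈X (trimA r))

      -- Since the k distinct vertices startB exhaust S+v, every matched end is one of them.
      σ-spec : ∀ r → ∃ λ s → startB s ≡ proj₁ (matchedEnd r)
      σ-spec r = injection-onto SB ∣SB∣≤k (startB , (λ r → LastHit.hit∈X (trimB r)) , startB-injective)
                                (proj₁ (proj₂ (matchedEnd r)))

    σ : Fin k → Fin k
    σ r = proj₁ (σ-spec r)

    startB∘σ : ∀ r → startB (σ r) ≡ proj₁ (matchedEnd r)
    startB∘σ r = proj₂ (σ-spec r)

    matchedσ : ∀ r → Matched (endA r) (startB (σ r))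
    matchedσ r = subst (Matched (endA r)) (sym (startB∘σ r)) (proj₂ (proj₂ (matchedEnd r)))

    σ-injective : ∀ {r s} → σ r ≡ σ s → r ≡ s
    σ-injective {r} {s} eq = endA-injective (matched-injective (matchedσ r) (matchedσ s) (cong startB eq))

    glue : ∀ {a z z′ b} → Walk Es′ a z → Walk Es′ z′ b → Matched z z′ → Walk Es a b
    glue p q (inj₁ (refl , _))    = mapW weakenAdj p ++W mapW weakenAdj q
    glue p q (inj₂ (refl , refl)) = mapW weakenAdj p ++W (u ∷⟨ uv ⟩ mapW weakenAdj q)

    glue-⊆ : ∀ {a z z′ b} (p : Walk Es′ a z) (q : Walk Es′ z′ b) c {t} → t ∈W glue p q c → t ∈W p ⊎ t ∈W q
    glue-⊆ p q (inj₁ (refl , _)) m =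
      Sum.map (mapW-⊆ weakenAdj p) (mapW-⊆ weakenAdj q) (∈-++W⁻ (mapW weakenAdj p) _ m)
    glue-⊆ p q (inj₂ (refl , refl)) m with ∈-++W⁻ (mapW weakenAdj p) (u ∷⟨ uv ⟩ mapW weakenAdj q) m
    ... | inj₁ m′         = inj₁ (mapW-⊆ weakenAdj p m′)
    ... | inj₂ (inj₁ refl) = inj₁ (end∈ p)
    ... | inj₂ (inj₂ m′)  = inj₂ (mapW-⊆ weakenAdj q m′)

    -- A vertex shared by an initial and a final piece is a vertex of S ending the
    -- first and starting the second: otherwise A and B would be joined avoiding S.
    crossing : ∀ r s {t} → t ∈W pieceA r → t ∈W pieceB s → t ∈ S × t ≡ endA r × t ≡ startB s
    crossing r s {t} t∈p t∈q with t ∈S? S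
    ... | yes t∈S = t∈S , hitsOnlyAtEnd⇒≡end (FirstHit.clean (trimA r)) t∈p (S⊆SA t∈S)
                        , hitsOnlyAtStart⇒≡start (pieceB s) (LastHit.clean (trimB s)) t∈q (S⊆SB t∈S)
    ... | no t∉S with fromA | toB
      where
      fromA : Reached t
      fromA with t ∈S? SA
      ... | yes t∈SA = subst Reached (Sum.[ (λ t∈S → ⊥-elim (t∉S t∈S)) , sym ] (SA-cases t∈SA)) ru
      ... | no t∉SA  = avoidingWalk (from∈A (proj₁ linkA r)) refl (prefixTo (pieceA r) t∈p)
                         λ z m z∈S → prefixTo-avoids (FirstHit.clean (trimA r)) t∈p t∉SA z m (S⊆SA z∈S)
      toB : Σ (Fin n) λ b → B b × Σ (Walk Es′ t b) (Avoids (_∈ S))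
      toB with t ∈S? SB
      ... | yes t∈SB = ⊥-elim (nv (subst Reached (Sum.[ (λ t∈S → ⊥-elim (t∉S t∈S)) , id ] (SB-cases t∈SB)) fromA))
      ... | no t∉SB  = _ , to∈B (proj₁ linkB s) , suffixFrom (pieceB s) t∈q ,
                         λ z m z∈S → suffixFrom-avoids (pieceB s) (LastHit.clean (trimB s)) t∈q t∉SB z m (S⊆SB z∈S)
    ... | ra | (_ , b∈B , q , avq) = ⊥-elim (viaReached ra b∈B q avq)

    glued : Fin k → ABWalk Es A B
    glued r = abWalk (from∈A (proj₁ linkA r)) (to∈B (proj₁ linkB (σ r))) (glue (pieceA r) (pieceB (σ r)) (matchedσ r))

    -- A vertex of S ending pieceA r is matched to itself.
    sharedEnd : ∀ r s {t} → t ∈ S × t ≡ endA r × t ≡ startB (σ s) → startB (σ r) ≡ startB (σ s)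
    sharedEnd r s (t∈S , refl , t≡) with matchedσ r
    ... | inj₁ (e , _) = trans (sym e) t≡
    ... | inj₂ (e , _) = ⊥-elim (u∉S (subst (_∈ S) e t∈S))

    glued-disjoint : ∀ {r s} → r ≢ s → DisjointW (walk (glued r)) (walk (glued s))
    glued-disjoint {r} {s} r≢s m₁ m₂
      with glue-⊆ (pieceA r) (pieceB (σ r)) (matchedσ r) m₁ | glue-⊆ (pieceA s) (pieceB (σ s)) (matchedσ s) m₂
    ... | inj₁ t∈pr | inj₁ t∈ps = proj₂ linkA r≢s (FirstHit.piece⊆ (trimA r) t∈pr) (FirstHit.piece⊆ (trimA s) t∈ps)
    ... | inj₂ t∈qr | inj₂ t∈qs =
      proj₂ linkB (r≢s ∘ σ-injective) (LastHit.piece⊆ (trimB (σ r)) t∈qr) (LastHit.piece⊆ (trimB (σ s)) t∈qs)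
    ... | inj₁ t∈pr | inj₂ t∈qs = r≢s (σ-injective (startB-injective (sharedEnd r s (crossing r (σ s) t∈pr t∈qs))))
    ... | inj₂ t∈qr | inj₁ t∈ps = r≢s (sym (σ-injective (startB-injective (sharedEnd s r (crossing s (σ r) t∈ps t∈qr)))))

    result : Linkage Es A B k
    result = glued , glued-disjoint

  linkage : Linkage Es A B k
  linkage with Reachability.avoidingWalk? Es′ A? (_≟F x) (_∈S? S) | Reachability.avoidingWalk? Es′ A? (_≟F y) (_∈S? S)
  ... | yes rx | yes ry = ⊥-elim (notBoth rx ry)
  ... | no nx  | no ny  = ⊥-elim (notNeither nx ny)
  ... | yes rx | no ny  = Rematch.result x y (inj₁ (here refl)) rx ny id
  ... | no nx  | yes ry = Rematch.result y x (inj₂ (here refl)) ry nx Sum.swap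

-- Induction on the edge list: if removing the first edge
-- leaves all separators large, use the induction hypothesis, else MengerStep.
menger : ∀ {n} (Es : List (Edge n)) (k : ℕ) {A B : Pred (Fin n) 0ℓ} → Decidable A → Decidable B →
         SeparatorBound Es A B k → Linkage Es A B k
menger []               k A? B? bound = menger-noEdges k A? B? bound
menger ((x , y) ∷ Es′) k {A} {B} A? B? bound
  with anySubset? (λ S → Reachability.separates? Es′ A? B? S ×-dec (suc ∣ S ∣ ≤? k))
... | yes (S , sepS , small) = MengerStep.linkage x y Es′ k (menger Es′ k) A? B? bound S sepS small
... | no noSmall = weaken (menger Es′ k A? B? bound′)
  where
  bound′ : SeparatorBound Es′ A B k
  bound′ S sepS with suc ∣ S ∣ ≤? k
  ... | yes small = ⊥-elim (noSmall (S , sepS , small))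
  ... | no ¬small = ≮⇒≥ ¬small
  weaken : Linkage Es′ A B k → Linkage ((x , y) ∷ Es′) A B k
  weaken (F , disjoint) = (λ r → abWalk (from∈A (F r)) (to∈B (F r)) (mapW weakenAdj (walk (F r))))
                        , λ r≢s m₁ m₂ → disjoint r≢s (mapW-⊆ weakenAdj _ m₁) (mapW-⊆ weakenAdj _ m₂)

_⊆ⱽ_ : ∀ {n} {Es : List (Edge n)} {a b} → Walk Es a b → Subset n → Set
w ⊆ⱽ X = ∀ {z} → z ∈W w → z ∈ X

record EdgeBramble {n} (Es : List (Edge n)) : Set where
  field
    sets     : List (Subset n)
    inhabited : ∀ {X} → X ∈ₗ sets → ∃ (_∈ X)
    connect  : ∀ {X} → X ∈ₗ sets → ∀ {u v} → u ∈ X → v ∈ X → Σ (Walk Es u v) (_⊆ⱽ X)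
    touch    : ∀ {X Y} → X ∈ₗ sets → Y ∈ₗ sets →
               (∃ λ z → z ∈ X × z ∈ Y) ⊎ (∃ λ a → ∃ λ b → a ∈ X × b ∈ Y × Adj Es a b)

  connect₂ : ∀ {X Y} → X ∈ₗ sets → Y ∈ₗ sets → ∀ {a b} → a ∈ X → b ∈ Y →
             Σ (Walk Es a b) λ w → ∀ {z} → z ∈W w → z ∈ X ⊎ z ∈ Y
  connect₂ X∈ Y∈ a∈ b∈ with touch X∈ Y∈
  ... | inj₁ (z , z∈X , z∈Y) =
    let (w₁ , w₁⊆) = connect X∈ a∈ z∈X ; (w₂ , w₂⊆) = connect Y∈ z∈Y b∈ in
    w₁ ++W w₂ , λ m → Sum.map w₁⊆ w₂⊆ (∈-++W⁻ w₁ w₂ m)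
  ... | inj₂ (c , d , c∈X , d∈Y , cd) =
    let (w₁ , w₁⊆) = connect X∈ a∈ c∈X ; (w₂ , w₂⊆) = connect Y∈ d∈Y b∈ in
    w₁ ++W (c ∷⟨ cd ⟩ w₂) , λ m → Sum.[ inj₁ ∘ w₁⊆ , Sum.[ (λ { refl → inj₁ c∈X }) , inj₂ ∘ w₂⊆ ] ] (∈-++W⁻ w₁ _ m)

∈-mapWith∈⁺ : ∀ {a} {A : Set a} {B : Set} (xs : List A) (f : ∀ {x} → x ∈ₗ xs → B) {x} (p : x ∈ₗ xs) →
              f p ∈ₗ mapWith∈ xs f
∈-mapWith∈⁺ (x ∷ xs) f (here refl) = here refl
∈-mapWith∈⁺ (x ∷ xs) f (there p)   = there (∈-mapWith∈⁺ xs (f ∘ there) p)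

-- Every bramble of G is a bramble of the graph spanned by the finitely many edges of
-- G used by the connectivity witnesses of its members and by their touchings.
module Spanning {n : ℕ} (G : Graph n) (B : Bramble G) where

  GEdge : Set
  GEdge = Σ (Edge n) λ (a , b) → _~_ G a b

  edgesAlong : (X : Subgraph G) (xs : List (Fin n)) → Linked (E X) xs → List GEdge
  edgesAlong X []            _       = []
  edgesAlong X (a ∷ [])      _       = []
  edgesAlong X (a ∷ b ∷ xs) (e ∷ l) = ((a , b) , E-edge X e) ∷ edgesAlong X (b ∷ xs) l

  connectingEdges : (X : Subgraph G) → Connected G X → Fin n → Fin n → List GEdge
  connectingEdges X (_ , c) u v with u ∈S? V X | v ∈S? V X
  ... | yes u∈ | yes v∈ = edgesAlong X (proj₁ (c u v u∈ v∈)) (proj₁ (proj₂ (c u v u∈ v∈)))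
  ... | _      | _      = []

  memberEdges : ∀ {X} → X ∈ₗ members B → List GEdge
  memberEdges {X} p = concatMap (λ u → concatMap (connectingEdges X (connected B p) u) (allFin n)) (allFin n)

  touchingEdges : ∀ X Y → Touch G X Y → List GEdge
  touchingEdges X Y (inj₁ _)                     = []
  touchingEdges X Y (inj₂ (a , b , _ , _ , a~b)) = ((a , b) , a~b) ∷ []

  internal external : List GEdge
  internal = concat (mapWith∈ (members B) memberEdges)
  external = concat (mapWith∈ (members B) λ {X} p → concat (mapWith∈ (members B) λ {Y} q → touchingEdges X Y (touching B p q)))

  Es : List (Edge n)
  Es = map proj₁ (internal ++ external)

  Es⊆G : ∀ {a b} → Adj Es a b → _~_ G a b
  Es⊆G (inj₁ m) with ∈-map⁻ proj₁ m
  ... | (_ , a~b) , _ , refl = a~b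
  Es⊆G (inj₂ m) with ∈-map⁻ proj₁ m
  ... | (_ , b~a) , _ , refl = ~-sym G b~a

  walkAlong : ∀ X (xs : List (Fin n)) (l : Linked (E X) xs) {u v} → head xs ≡ just u → last xs ≡ just v →
              u ∈ V X → (∀ {e} → e ∈ₗ edgesAlong X xs l → proj₁ e ∈ₗ Es) → Σ (Walk Es u v) (_⊆ⱽ V X)
  walkAlong X (a ∷ []) l refl refl u∈ _ = [ a ] , λ { refl → u∈ }
  walkAlong X (a ∷ b ∷ xs) (e ∷ l) refl lst u∈ inEs
    with walkAlong X (b ∷ xs) l refl lst (proj₂ (E-ends X e)) (inEs ∘ there)
  ... | w , w⊆ = a ∷⟨ inj₁ (inEs (here refl)) ⟩ w , λ { (inj₁ refl) → u∈ ; (inj₂ m) → w⊆ m }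

  connectingWalk : ∀ X (c : Connected G X) {u v} → u ∈ V X → v ∈ V X →
                   (∀ {e} → e ∈ₗ connectingEdges X c u v → proj₁ e ∈ₗ Es) → Σ (Walk Es u v) (_⊆ⱽ V X)
  connectingWalk X (_ , c) {u} {v} u∈ v∈ inEs with u ∈S? V X | v ∈S? V X
  ... | yes u∈′ | yes v∈′ = let (xs , l , hd , lst) = c u v u∈′ v∈′ in walkAlong X xs l hd lst u∈ inEs
  ... | no u∉   | _       = ⊥-elim (u∉ u∈)
  ... | yes _   | no v∉   = ⊥-elim (v∉ v∈)

  bramble : EdgeBramble Es
  bramble = record { sets = map V (members B) ; inhabited = inhabited ; connect = connect ; touch = touch }
    where
    inhabited : ∀ {X} → X ∈ₗ map V (members B) → ∃ (_∈ X)
    inhabited m with ∈-map⁻ V m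
    ... | X , p , refl = proj₁ (connected B p)

    internal⊆Es : ∀ {X} (p : X ∈ₗ members B) {e} → e ∈ₗ memberEdges p → proj₁ e ∈ₗ Es
    internal⊆Es p m = ∈-map⁺ proj₁ (∈-++⁺ˡ (∈-concat⁺′ m (∈-mapWith∈⁺ (members B) memberEdges p)))

    external⊆Es : ∀ {X Y} (p : X ∈ₗ members B) (q : Y ∈ₗ members B) {e} → e ∈ₗ touchingEdges X Y (touching B p q) →
                  proj₁ e ∈ₗ Es
    external⊆Es {X} {Y} p q m = ∈-map⁺ proj₁ (∈-++⁺ʳ internal (∈-concat⁺′ (∈-concat⁺′ m
      (∈-mapWith∈⁺ (members B) (λ {Y} q → touchingEdges X Y (touching B p q)) q))
      (∈-mapWith∈⁺ (members B) (λ {X} p → concat (mapWith∈ (members B) λ {Y} q → touchingEdges X Y (touching B p q))) p)))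

    connect : ∀ {X} → X ∈ₗ map V (members B) → ∀ {u v} → u ∈ X → v ∈ X → Σ (Walk Es u v) (_⊆ⱽ X)
    connect m {u} {v} u∈ v∈ with ∈-map⁻ V m
    ... | X , p , refl = connectingWalk X (connected B p) u∈ v∈ λ e∈ → internal⊆Es p
      (∈-concatMap⁺ _ (lose (∈-allFin u) (∈-concatMap⁺ _ (lose (∈-allFin v) e∈))))

    touch : ∀ {X Y} → X ∈ₗ map V (members B) → Y ∈ₗ map V (members B) →
            (∃ λ z → z ∈ X × z ∈ Y) ⊎ (∃ λ a → ∃ λ b → a ∈ X × b ∈ Y × Adj Es a b)
    touch mX mY with ∈-map⁻ V mX | ∈-map⁻ V mY
    ... | X , p , refl | Y , q , refl with touching B p q | external⊆Es p q
    ...   | inj₁ shared                 | _    = inj₁ shared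
    ...   | inj₂ (a , b , a∈ , b∈ , _) | inEs = inj₂ (a , b , a∈ , b∈ , inj₁ (inEs (here refl)))

-- A path meeting every member of a bramble.

module _ {a} {A : Set a} {Q : A → Set} (Q? : ∀ x → Dec (Q x)) where

  countNot : List A → ℕ
  countNot [] = 0
  countNot (x ∷ xs) with Q? x
  ... | yes _ = countNot xs
  ... | no _  = suc (countNot xs)

module _ {a} {A : Set a} {Q Q′ : A → Set} (Q? : ∀ x → Dec (Q x)) (Q′? : ∀ x → Dec (Q′ x)) (Q⇒Q′ : ∀ {x} → Q x → Q′ x) where

  countNot-mono : ∀ xs → countNot Q′? xs ≤ countNot Q? xs
  countNot-mono [] = z≤n
  countNot-mono (x ∷ xs) with Q? x | Q′? x
  ... | yes q | no ¬q′ = ⊥-elim (¬q′ (Q⇒Q′ q))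
  ... | yes _ | yes _  = countNot-mono xs
  ... | no _  | yes _  = m≤n⇒m≤1+n (countNot-mono xs)
  ... | no _  | no _   = s≤s (countNot-mono xs)

  countNot-strict : ∀ xs → Any (λ x → Q′ x × ¬ Q x) xs → countNot Q′? xs < countNot Q? xs
  countNot-strict (x ∷ xs) (here (q′ , ¬q)) with Q? x | Q′? x
  ... | yes q | _      = ⊥-elim (¬q q)
  ... | no _  | no ¬q′ = ⊥-elim (¬q′ q′)
  ... | no _  | yes _  = s≤s (countNot-mono xs)
  countNot-strict (x ∷ xs) (there p) with Q? x | Q′? x
  ... | yes q | no ¬q′ = ⊥-elim (¬q′ (Q⇒Q′ q))
  ... | yes _ | yes _  = countNot-strict xs p
  ... | no _  | yes _  = m≤n⇒m≤1+n (countNot-strict xs p)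
  ... | no _  | no _   = s≤s (countNot-strict xs p)

module MeetingPath {n : ℕ} {Es : List (Edge n)} (𝔅 : EdgeBramble Es) where
  open EdgeBramble 𝔅

  record Spine : Set where
    field
      {start end} : Fin n
      path        : Walk Es start end
      isPath      : IsPath path
      meetsAll    : ∀ {X} → X ∈ₗ sets → Meets (_∈ X) path

  -- The invariant of the greedy construction: a path that ends in a member Y and
  -- meets Y only there.
  record Growing : Set where
    field
      {start end} : Fin n
      path        : Walk Es start end
      isPath      : IsPath path
      {Y}         : Subset n
      Y∈          : Y ∈ₗ sets
      end∈Y       : end ∈ Y
      onlyAtEnd   : ∀ {z} → z ∈W path → z ∈ Y → z ≡ end

  unmet : Growing → ℕ
  unmet g = countNot (λ X → meets? (_∈S? X) (Growing.path g)) sets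

  record Extension (g : Growing) : Set where
    field
      {d}           : Fin n
      step          : Walk Es (Growing.end g) d
      stepIsPath    : IsPath step
      junction      : ∀ {z} → z ∈W Growing.path g → z ∈W step → z ≡ Growing.end g
      {Yd}          : Subset n
      Yd∈           : Yd ∈ₗ sets
      d∈Yd          : d ∈ Yd
      unmetYd       : ¬ Meets (_∈ Yd) (Growing.path g)
      stepOnlyAtEnd : ∀ {z} → z ∈W step → z ∈ Yd → z ≡ d

  -- If a member Y₀ is not met, walk inside Y ∪ Y₀ from the end of the path to Y₀,
  -- stop at the first vertex lying in an unmet member, and cut out cycles.
  extension : (g : Growing) → ∀ {Y₀} → Y₀ ∈ₗ sets → ¬ Meets (_∈ Y₀) (Growing.path g) → Extension g
  extension g {Y₀} Y₀∈ unmetY₀ = record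
    { step = W₂ ; stepIsPath = proj₂ (proj₂ shortened) ; junction = junction
    ; Yd∈ = proj₁ (proj₂ (find hit∈X)) ; d∈Yd = proj₁ (proj₂ (proj₂ (find hit∈X)))
    ; unmetYd = proj₂ (proj₂ (proj₂ (find hit∈X)))
    ; stepOnlyAtEnd = λ z∈ z∈Yd → hitsOnlyAtEnd⇒≡end clean (proj₁ (proj₂ shortened) z∈)
                        (lose (proj₁ (proj₂ (find hit∈X))) (z∈Yd , proj₂ (proj₂ (proj₂ (find hit∈X))))) }
    where
    open Growing g
    Fresh : Fin n → Set
    Fresh z = Any (λ X → z ∈ X × ¬ Meets (_∈ X) path) sets
    fresh? : Decidable Fresh
    fresh? z = Any.any? (λ X → (z ∈S? X) ×-dec ¬? (meets? (_∈S? X) path)) sets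
    t : Fin n
    t = proj₁ (inhabited Y₀∈)
    t∈Y₀ : t ∈ Y₀
    t∈Y₀ = proj₂ (inhabited Y₀∈)
    W : Walk Es end t
    W = proj₁ (connect₂ Y∈ Y₀∈ end∈Y t∈Y₀)
    W⊆ : ∀ {z} → z ∈W W → z ∈ Y ⊎ z ∈ Y₀
    W⊆ = proj₂ (connect₂ Y∈ Y₀∈ end∈Y t∈Y₀)
    first : FirstHit Fresh W
    first = firstHit fresh? W (t , end∈ W , lose Y₀∈ (t∈Y₀ , unmetY₀))
    open FirstHit first renaming (piece to W₁)
    shortened : Σ (Walk Es end hit) λ p → p ⊆W W₁ × IsPath p
    shortened = shortcut W₁
    W₂ : Walk Es end hit
    W₂ = proj₁ shortened
    junction : ∀ {z} → z ∈W path → z ∈W W₂ → z ≡ end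
    junction z∈ z∈W₂ with W⊆ (piece⊆ (proj₁ (proj₂ shortened) z∈W₂))
    ... | inj₁ z∈Y  = onlyAtEnd z∈ z∈Y
    ... | inj₂ z∈Y₀ = ⊥-elim (unmetY₀ (_ , z∈ , z∈Y₀))

  extend : (g : Growing) → ∀ {Y₀} → Y₀ ∈ₗ sets → ¬ Meets (_∈ Y₀) (Growing.path g) →
           Σ Growing λ g′ → unmet g′ < unmet g
  extend g Y₀∈ unmetY₀ = g′ , fewer
    where
    open Growing g
    open Extension (extension g Y₀∈ unmetY₀)
    path′ : Walk Es start d
    path′ = path ++W step
    g′ : Growing
    g′ = record
      { path = path′ ; isPath = ++W-isPath path step isPath stepIsPath junction
      ; Y∈ = Yd∈ ; end∈Y = d∈Yd ; onlyAtEnd = onlyAtEnd′ }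
      where
      onlyAtEnd′ : ∀ {z} → z ∈W path′ → z ∈ Yd → z ≡ d
      onlyAtEnd′ m z∈Yd with ∈-++W⁻ path step m
      ... | inj₁ z∈ = ⊥-elim (unmetYd (_ , z∈ , z∈Yd))
      ... | inj₂ z∈ = stepOnlyAtEnd z∈ z∈Yd
    fewer : unmet g′ < unmet g
    fewer = countNot-strict (λ X → meets? (_∈S? X) path) (λ X → meets? (_∈S? X) path′)
              (λ (z , m , z∈X) → z , ∈-++W⁺ˡ path step m , z∈X) sets
              (lose Yd∈ ((d , ∈-++W⁺ʳ path step (end∈ step) , d∈Yd) , unmetYd))

  -- Extend until every member is met; the number of unmet members bounds the steps.
  grow : ∀ m (g : Growing) → unmet g ≤ m → Spine
  grow m g bound with All.all? (λ X → meets? (_∈S? X) (Growing.path g)) sets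
  ... | yes all = record { isPath = Growing.isPath g ; meetsAll = All.lookup all }
  ... | no ¬all with find (AllP.¬All⇒Any¬ (λ X → meets? (_∈S? X) (Growing.path g)) sets ¬all)
  ...   | _ , Y₀∈ , unmetY₀ with extend g Y₀∈ unmetY₀ | m
  ...     | g′ , fewer | zero   = ⊥-elim (n≮0 (≤-trans fewer bound))
  ...     | g′ , fewer | suc m′ = grow m′ g′ (≤-pred (≤-trans fewer bound))

  spine : ∀ {Y} → Y ∈ₗ sets → ∀ {c} → c ∈ Y → Spine
  spine Y∈ c∈ = grow _ g₀ ≤-refl
    where
    g₀ : Growing
    g₀ = record { path = [ _ ] ; isPath = tt ; Y∈ = Y∈ ; end∈Y = c∈ ; onlyAtEnd = λ z≡ _ → z≡ }

-- Cutting a path into segments each meeting a sub-bramble of order k.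

Infix : ∀ {A : Set} → List A → List A → Set
Infix s L = ∃ λ pre → ∃ λ post → pre ++ (s ++ post) ≡ L

module _ {A : Set} where

  unique-++⁻ : ∀ (xs : List A) {ys} → Unique (xs ++ ys) →
               Unique xs × Unique ys × (∀ {z} → z ∈ₗ xs → z ∈ₗ ys → ⊥)
  unique-++⁻ []       ys!         = [] , ys! , λ ()
  unique-++⁻ (x ∷ xs) (x∉ ∷ xys!) with unique-++⁻ xs xys! | AllP.++⁻ xs x∉
  ... | xs! , ys! , apart | x∉xs , x∉ys = x∉xs ∷ xs! , ys! , λ { (here refl) m → All.lookup x∉ys m refl ; (there z∈) → apart z∈ }

  linked-++⁻ : ∀ {R : A → A → Set} (xs : List A) {ys} → Linked R (xs ++ ys) → Linked R xs × Linked R ys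
  linked-++⁻ []           l       = [] , l
  linked-++⁻ (x ∷ [])     l       = [-] , L.tail l
  linked-++⁻ (x ∷ y ∷ xs) (r ∷ l) = Data.Product.map₁ (r ∷_) (linked-++⁻ (y ∷ xs) l)

  infix-∈ : ∀ {s L : List A} {z} → Infix s L → z ∈ₗ s → z ∈ₗ L
  infix-∈ (pre , post , refl) m = ∈-++⁺ʳ pre (∈-++⁺ˡ m)

  infix-unique : ∀ {s L : List A} → Infix s L → Unique L → Unique s
  infix-unique {s} (pre , post , refl) L! = proj₁ (unique-++⁻ s (proj₁ (proj₂ (unique-++⁻ pre L!))))

  infix-linked : ∀ {R : A → A → Set} {s L : List A} → Infix s L → Linked R L → Linked R s
  infix-linked {s = s} (pre , post , refl) l = proj₁ (linked-++⁻ s (proj₂ (linked-++⁻ pre l)))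

module Segments {n : ℕ} (Ms : List (Subset n)) (k : ℕ) where

  Hits : Subset n → Subset n → Set
  Hits S X = ∃ λ z → z ∈ S × z ∈ X

  hits? : ∀ S X → Dec (Hits S X)
  hits? S X = any? (λ z → (z ∈S? S) ×-dec (z ∈S? X))

  MeetsL : List (Fin n) → Subset n → Set
  MeetsL L X = ∃ λ z → z ∈ₗ L × z ∈ X

  meetsL? : ∀ L X → Dec (MeetsL L X)
  meetsL? L X with Any.any? (_∈S? X) L
  ... | yes p = yes (find p)
  ... | no ¬p = no λ (_ , z∈ , z∈X) → ¬p (lose z∈ z∈X)

  Covers : (Subset n → Set) → Subset n → Set
  Covers Q S = ∀ {X} → X ∈ₗ Ms → Q X → Hits S X

  Order≥ : (Subset n → Set) → ℕ → Set
  Order≥ Q m = ∀ S → Covers Q S → m ≤ ∣ S ∣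

  _meeting_ : (Subset n → Set) → List (Fin n) → Subset n → Set
  (Q meeting L) X = Q X × MeetsL L X

  order-mono : ∀ {Q Q′ : Subset n → Set} {m m′} → (∀ {X} → X ∈ₗ Ms → Q X → Q′ X) → m′ ≤ m →
               Order≥ Q m → Order≥ Q′ m′
  order-mono Q⇒Q′ m′≤m ord S cover = ≤-trans m′≤m (ord S λ X∈ q → cover X∈ (Q⇒Q′ X∈ q))

  module _ {Q : Subset n → Set} (Q? : Decidable Q) where

    covers-or-misses : ∀ S → Covers Q S ⊎ (Σ (Subset n) λ X → X ∈ₗ Ms × Q X × ¬ Hits S X)
    covers-or-misses S with All.all? (λ X → Q? X →-dec hits? S X) Ms
    ... | yes all = inj₁ (All.lookup all)
    ... | no ¬all with find (AllP.¬All⇒Any¬ (λ X → Q? X →-dec hits? S X) Ms ¬all)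
    ...   | X , X∈ , ¬imp with Q? X
    ...     | yes q = inj₂ (X , X∈ , q , λ h → ¬imp λ _ → h)
    ...     | no ¬q = ⊥-elim (¬imp λ q → ⊥-elim (¬q q))

    missed : ∀ {m} → Order≥ Q m → ∀ S → suc ∣ S ∣ ≤ m → Σ (Subset n) λ X → X ∈ₗ Ms × Q X × ¬ Hits S X
    missed ord S small with covers-or-misses S
    ... | inj₁ cover = ⊥-elim (<-irrefl refl (≤-trans small (ord S cover)))
    ... | inj₂ miss  = miss

    order≥? : ∀ m → Order≥ Q m ⊎ (Σ (Subset n) λ S → Covers Q S × suc ∣ S ∣ ≤ m)
    order≥? m with anySubset? (λ S → covers? S ×-dec (suc ∣ S ∣ ≤? m))
      where
      covers? : ∀ S → Dec (Covers Q S)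
      covers? S with covers-or-misses S
      ... | inj₁ cover = yes cover
      ... | inj₂ (X , X∈ , q , miss) = no λ cover → miss (cover X∈ q)
    ... | yes small = inj₂ small
    ... | no ¬small = inj₁ λ S cover → ≮⇒≥ λ lt → ¬small (S , cover , lt)

  Rich : List (Fin n) → Set
  Rich L = ∀ S → suc ∣ S ∣ ≤ k → Σ (Subset n) λ X → X ∈ₗ Ms × MeetsL L X × ¬ Hits S X

  rich-nonempty : 1 ≤ k → ∀ {L} → Rich L → L ≢ []
  rich-nonempty 1≤k rich refl with rich ∅ (≤-trans (s≤s (≤-reflexive (∣⊥∣≡0 n))) 1≤k)
  ... | _ , _ , (_ , () , _) , _

  richOf : ∀ {Q} → Decidable Q → ∀ L → Order≥ (Q meeting L) k → Rich L
  richOf Q? L ord S small = let (X , X∈ , (_ , meets) , miss) = missed (λ X → Q? X ×-dec meetsL? L X) ord S small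
                            in X , X∈ , meets , miss

  record Segmentation (t : ℕ) (L : List (Fin n)) : Set where
    field
      segment  : Fin (suc t) → List (Fin n)
      rich     : ∀ i → Rich (segment i)
      infixOf  : ∀ i → Infix (segment i) L
      disjoint : ∀ {i j} → i ≢ j → ∀ {z} → z ∈ₗ segment i → z ∈ₗ segment j → ⊥

  SmallCover : (Subset n → Set) → List (Fin n) → Set
  SmallCover Q q = Σ (Subset n) λ S → Covers (Q meeting q) S × suc ∣ S ∣ ≤ k

  emptyCover : ∀ {Q} → 1 ≤ k → SmallCover Q []
  emptyCover 1≤k = ∅ , (λ { _ (_ , _ , () , _) }) , ≤-trans (s≤s (≤-reflexive (∣⊥∣≡0 n))) 1≤k

  record RichPrefix (Q : Subset n → Set) (L : List (Fin n)) : Set where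
    field
      q′       : List (Fin n)
      v        : Fin n
      r        : List (Fin n)
      splits   : q′ ++ v ∷ r ≡ L
      cover′   : SmallCover Q q′
      richLast : Order≥ (Q meeting (q′ ++ v ∷ [])) k

  shortestRichPrefix : ∀ {Q} (Q? : Decidable Q) L (pre rest : List (Fin n)) → pre ++ rest ≡ L →
                       SmallCover Q pre → Order≥ (Q meeting L) k → RichPrefix Q L
  shortestRichPrefix Q? L pre [] eq (S , cover , small) ord =
    ⊥-elim (<-irrefl refl (≤-trans small (ord S λ X∈ (q , z , z∈ , z∈X) → cover X∈ (q , z , pre⊇L z∈ , z∈X))))
    where
    pre⊇L : ∀ {z} → z ∈ₗ L → z ∈ₗ pre
    pre⊇L = subst (_ ∈ₗ_) (trans (sym eq) (++-identityʳ pre))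
  shortestRichPrefix Q? L pre (x ∷ rest) eq smallCover ord with order≥? (λ X → Q? X ×-dec meetsL? (pre ++ x ∷ []) X) k
  ... | inj₁ ord′  = record { splits = eq ; cover′ = smallCover ; richLast = ord′ }
  ... | inj₂ cover = shortestRichPrefix Q? L (pre ++ x ∷ []) rest (trans (++-assoc pre (x ∷ []) rest) eq) cover ord

  record Cut (Q : Subset n → Set) (L : List (Fin n)) (t : ℕ) : Set where
    field
      q r    : List (Fin n)
      q++r≡L : q ++ r ≡ L
      rich-q : Rich q
      meetR  : ∀ {X} → X ∈ₗ Ms → Q X × ¬ MeetsL q X → MeetsL r X
      ordR   : Order≥ (λ X → Q X × ¬ MeetsL q X) (k * suc t)

  -- Cut off the shortest rich prefix q = q′ ++ [v]: a cover S of the members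
  -- missing q, together with the small cover S′ of q′ and v, covers all members, so
  -- |S| + |S′| + 1 ≥ k(t+2) forces |S| ≥ k(t+1).
  cut : 1 ≤ k → ∀ t {Q : Subset n → Set} → Decidable Q → (L : List (Fin n)) →
        (∀ {X} → X ∈ₗ Ms → Q X → MeetsL L X) → Order≥ Q (k * suc (suc t)) → Cut Q L t
  cut 1≤k t {Q} Q? L meetL ord = record
    { q = q ; r = r ; q++r≡L = q++r≡L ; rich-q = richOf Q? q richLast ; meetR = meetR ; ordR = ordR }
    where
    ordL : Order≥ (Q meeting L) k
    ordL = order-mono (λ X∈ qX → qX , meetL X∈ qX) (≤-trans (m≤m+n k _) (≤-reflexive (sym (*-suc k (suc t))))) ord
    open RichPrefix (shortestRichPrefix Q? L [] L refl (emptyCover 1≤k) ordL)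
    S′ : Subset n
    S′ = proj₁ cover′
    q : List (Fin n)
    q = q′ ++ v ∷ []
    q++r≡L : q ++ r ≡ L
    q++r≡L = trans (++-assoc q′ (v ∷ []) r) splits

    meetR : ∀ {X} → X ∈ₗ Ms → Q X × ¬ MeetsL q X → MeetsL r X
    meetR X∈ (qX , missq) with meetL X∈ qX
    ... | z , z∈L , z∈X with ∈-++⁻ q (subst (z ∈ₗ_) (sym q++r≡L) z∈L)
    ...   | inj₁ z∈q = ⊥-elim (missq (z , z∈q , z∈X))
    ...   | inj₂ z∈r = z , z∈r , z∈X

    extendCover : ∀ {S} → Covers (λ X → Q X × ¬ MeetsL q X) S → Covers Q ((S ∪ S′) ∪ ⁅ v ⁆)
    extendCover {S} cover {X} X∈ qX with meetsL? q X
    ... | no missq = let (z , z∈S , z∈X) = cover X∈ (qX , missq) in z , x∈p∪q⁺ (inj₁ (x∈p∪q⁺ (inj₁ z∈S))) , z∈X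
    ... | yes (z , z∈q , z∈X) with ∈-++⁻ q′ z∈q
    ...   | inj₁ z∈q′ = let (z′ , z′∈S′ , z′∈X) = proj₁ (proj₂ cover′) X∈ (qX , z , z∈q′ , z∈X) in
                        z′ , x∈p∪q⁺ (inj₁ (x∈p∪q⁺ (inj₂ z′∈S′))) , z′∈X
    ...   | inj₂ (here refl) = v , x∈p∪q⁺ (inj₂ (x∈⁅x⁆ v)) , z∈X

    ordR : Order≥ (λ X → Q X × ¬ MeetsL q X) (k * suc t)
    ordR S cover = ≮⇒≥ λ small → n≮n _ (begin-strict
      suc (∣ S ∣ + ∣ S′ ∣)          <⟨ s≤s (≤-reflexive (sym (+-suc ∣ S ∣ ∣ S′ ∣))) ⟩
      suc ∣ S ∣ + suc ∣ S′ ∣         ≤⟨ +-mono-≤ small (proj₂ (proj₂ cover′)) ⟩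
      k * suc t + k                 ≡⟨ +-comm (k * suc t) k ⟩
      k + k * suc t                 ≡⟨ *-suc k (suc t) ⟨
      k * suc (suc t)               ≤⟨ ord _ (extendCover cover) ⟩
      ∣ (S ∪ S′) ∪ ⁅ v ⁆ ∣           ≤⟨ ∣p∪⁅x⁆∣≤1+∣p∣ (S ∪ S′) v ⟩
      suc ∣ S ∪ S′ ∣                 ≤⟨ s≤s (∣p∪q∣≤∣p∣+∣q∣ S S′) ⟩
      suc (∣ S ∣ + ∣ S′ ∣)          ∎)
      where open ≤-Reasoning

  segments : 1 ≤ k → ∀ t {Q : Subset n → Set} → Decidable Q → (L : List (Fin n)) → Unique L →
             (∀ {X} → X ∈ₗ Ms → Q X → MeetsL L X) → Order≥ Q (k * suc t) → Segmentation t L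
  segments 1≤k zero Q? L L! meetL ord = record
    { segment  = λ _ → L
    ; rich     = λ _ → richOf Q? L (order-mono (λ X∈ qX → qX , meetL X∈ qX) (≤-reflexive (sym (*-identityʳ k))) ord)
    ; infixOf  = λ _ → [] , [] , ++-identityʳ L
    ; disjoint = λ { {zero} {zero} i≢j → ⊥-elim (i≢j refl) } }
  segments 1≤k (suc t) {Q} Q? L L! meetL ord =
    record { segment = segment ; rich = rich ; infixOf = infixOf ; disjoint = disjoint }
    where
    open Cut (cut 1≤k t Q? L meetL ord)
    split : Unique q × Unique r × (∀ {z} → z ∈ₗ q → z ∈ₗ r → ⊥)
    split = unique-++⁻ q (subst Unique (sym q++r≡L) L!)
    rest : Segmentation t r
    rest = segments 1≤k t (λ X → Q? X ×-dec ¬? (meetsL? q X)) r (proj₁ (proj₂ split)) meetR ordR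
    open Segmentation rest renaming (segment to segment′; rich to rich′; infixOf to infixOf′; disjoint to disjoint′)

    segment : Fin (suc (suc t)) → List (Fin n)
    segment zero    = q
    segment (suc i) = segment′ i

    rich : ∀ i → Rich (segment i)
    rich zero    = rich-q
    rich (suc i) = rich′ i

    infixOf : ∀ i → Infix (segment i) L
    infixOf zero    = [] , r , q++r≡L
    infixOf (suc i) = let (pre , post , eq) = infixOf′ i in
      q ++ pre , post , trans (++-assoc q pre _) (trans (cong (q ++_) eq) q++r≡L)

    disjoint : ∀ {i j} → i ≢ j → ∀ {z} → z ∈ₗ segment i → z ∈ₗ segment j → ⊥
    disjoint {zero}  {zero}  i≢j = ⊥-elim (i≢j refl)
    disjoint {zero}  {suc j} _ m₁ m₂ = proj₂ (proj₂ split) m₁ (infix-∈ (infixOf′ j) m₂)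
    disjoint {suc i} {zero}  _ m₁ m₂ = proj₂ (proj₂ split) m₂ (infix-∈ (infixOf′ i) m₁)
    disjoint {suc i} {suc j} i≢j = disjoint′ (i≢j ∘ cong suc)

-- From linkages of walks to paths of G.

record ABPath {n} (Es : List (Edge n)) (A B : Pred (Fin n) 0ℓ) : Set where
  field
    {from to}   : Fin n
    from∈A      : A from
    to∈B        : B to
    path        : Walk Es from to
    isPath      : IsPath path
    onlyFirstInA : ∀ {z} → z ∈W path → A z → z ≡ from
    onlyLastInB  : ∀ {z} → z ∈W path → B z → z ≡ to

-- Every A–B walk contains such a path: start at its last vertex in A, stop at the
-- next vertex in B, and cut out cycles.
abPath : ∀ {n} {Es : List (Edge n)} {A B : Pred (Fin n) 0ℓ} → Decidable A → Decidable B →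
         (W : ABWalk Es A B) → Σ (ABPath Es A B) λ P → ABPath.path P ⊆W walk W
abPath A? B? (abWalk a∈A b∈B W) with lastHit A? W (_ , start∈ W , a∈A)
... | lastHitAt a′∈A W₁ W₁⊆ onlyStartA with firstHit B? W₁ (_ , end∈ W₁ , b∈B)
...   | firstHitAt b′∈B W₂ W₂⊆ onlyEndB with shortcut W₂
...     | W₃ , W₃⊆ , W₃-path = record
          { from∈A = a′∈A ; to∈B = b′∈B ; path = W₃ ; isPath = W₃-path
          ; onlyFirstInA = λ m z∈A → hitsOnlyAtStart⇒≡start W₁ onlyStartA (W₂⊆ (W₃⊆ m)) z∈A
          ; onlyLastInB  = λ m z∈B → hitsOnlyAtEnd⇒≡end onlyEndB (W₃⊆ m) z∈B }
        , W₁⊆ ∘ W₂⊆ ∘ W₃⊆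

graphPath : ∀ {n} (G : Graph n) {Es : List (Edge n)} → (∀ {u v} → Adj Es u v → _~_ G u v) →
            ∀ {a b} (w : Walk Es a b) → IsPath w → Path G
graphPath G Es⊆G w w-path = record
  { verts = toList w ; nonempty = toList-nonempty w ; distinct = toList-unique w w-path
  ; adjacent = toList-linked Es⊆G w }

-- The construction behind the theorem, for ℓ = t + 1 (steps 1–3 of the overview).
module Construction (k t : ℕ) (1≤k : 1 ≤ k) {n : ℕ} (G : Graph n) (B : Bramble G)
                    (ord : OrderAtLeast G B (k * suc t)) where
  open Spanning G B using (Es; Es⊆G; bramble)
  open EdgeBramble bramble
  open Segments sets k

  ordAll : Order≥ (λ _ → ⊤) (k * suc t)
  ordAll S cover = ord S λ p → cover (∈-map⁺ V p) tt

  -- A member exists, as the empty set is not a hitting set.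
  someMember : Σ (Subset n) λ X → X ∈ₗ sets × ⊤ × ¬ Hits ∅ X
  someMember = missed (λ _ → yes tt) ordAll ∅ (≤-trans (s≤s (≤-reflexive (∣⊥∣≡0 n))) (≤-trans 1≤k (m≤m*n k (suc t))))

  spine : MeetingPath.Spine bramble
  spine = let (_ , X∈ , _) = someMember in MeetingPath.spine bramble X∈ (proj₂ (inhabited X∈))
  open MeetingPath.Spine spine

  L : List (Fin n)
  L = toList path

  segmentation : Segmentation t L
  segmentation = segments 1≤k t (λ _ → yes tt) L (toList-unique path isPath)
                   (λ X∈ _ → let (z , z∈ , z∈X) = meetsAll X∈ in z , toList-∈⁺ path z∈ , z∈X) ordAll
  open Segmentation segmentation

  P : Fin (suc t) → Path G
  P i = record
    { verts = segment i ; nonempty = rich-nonempty 1≤k (rich i)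
    ; distinct = infix-unique (infixOf i) (toList-unique path isPath)
    ; adjacent = infix-linked (infixOf i) (toList-linked Es⊆G path) }

  P-disjoint : ∀ i j → i ≢ j → Disjoint G (P i) (P j)
  P-disjoint i j i≢j _ = disjoint i≢j

  In : Fin (suc t) → Pred (Fin n) 0ℓ
  In i z = z ∈ₗ segment i

  in? : ∀ i → Decidable (In i)
  in? i z = DecMem._∈?_ _≟F_ z (segment i)

  -- Two segments cannot be separated by fewer than k vertices: S misses members
  -- X and Y meeting them, and X ∪ Y contains a walk between the segments.
  segments-linked : ∀ i j → SeparatorBound Es (In i) (In j) k
  segments-linked i j S sep = ≮⇒≥ λ small →
    let (X , X∈ , (a , a∈ , a∈X) , missX) = rich i S small
        (Y , Y∈ , (b , b∈ , b∈Y) , missY) = rich j S small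
        (w , w⊆) = connect₂ X∈ Y∈ a∈X b∈Y
        (z , z∈w , z∈S) = sep a∈ b∈ w
    in Sum.[ (λ z∈X → missX (z , z∈S , z∈X)) , (λ z∈Y → missY (z , z∈S , z∈Y)) ] (w⊆ z∈w)

  linkage : ∀ i j → Linkage Es (In i) (In j) k
  linkage i j = menger Es k (in? i) (in? j) (segments-linked i j)

  trimmed : ∀ i j r → Σ (ABPath Es (In i) (In j)) λ Q → ABPath.path Q ⊆W walk (proj₁ (linkage i j) r)
  trimmed i j r = abPath (in? i) (in? j) (proj₁ (linkage i j) r)

  Q : ∀ i j → Fin k → Path G
  Q i j r = graphPath G Es⊆G _ (ABPath.isPath (proj₁ (trimmed i j r)))

  Q-between : ∀ i j r → PathBetween G (P i) (P j) (Q i j r)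
  Q-between i j r = (R.from , toList-head R.path , R.from∈A) , (R.to , toList-last R.path , R.to∈B)
                  , (λ v m v∈ → trans (toList-head R.path) (cong just (sym (R.onlyFirstInA (toList-∈⁻ R.path m) v∈))))
                  , (λ v m v∈ → trans (toList-last R.path) (cong just (sym (R.onlyLastInB (toList-∈⁻ R.path m) v∈))))
    where module R = ABPath (proj₁ (trimmed i j r))

  Q-disjoint : ∀ i j r s → r ≢ s → Disjoint G (Q i j r) (Q i j s)
  Q-disjoint i j r s r≢s v m₁ m₂ =
    proj₂ (linkage i j) r≢s (proj₂ (trimmed i j r) (toList-∈⁻ _ m₁)) (proj₂ (trimmed i j s) (toList-∈⁻ _ m₂))

lemma7 : (k ℓ : ℕ) → 1 ≤ k → 1 ≤ ℓ → {n : ℕ} (G : Graph n) →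
    (Σ (Bramble G) λ B → OrderAtLeast G B (k * ℓ)) →
    Σ (Fin ℓ → Path G) λ P → ((∀ (i j : Fin ℓ) → i ≢ j → Disjoint G (P i) (P j)) ×
    (∀ (i j : Fin ℓ) → i ≢ j →
    Σ (Fin k → Path G) λ Q → ((∀ (r : Fin k) → PathBetween G (P i) (P j) (Q r)) ×
    (∀ (r s : Fin k) → r ≢ s → Disjoint G (Q r) (Q s)))))
lemma7 k (suc t) 1≤k _ G (B , ord) =
  P , P-disjoint , λ i j _ → Q i j , Q-between i j , Q-disjoint i j
  where open Construction k t 1≤k G B ord
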